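{- Let $n\geq1$, let $M\in\mathbb{Z}^{n\times n}$ be an integral matrix with $\det M\neq0$, and let $t\geq1$ be an integer. Then: (a) a set $\mathcal{L}$ of unit cubes is a hyper-L of $G_M$ if and only if $t\mathcal{L}$ is a hyper-L of $G_{tM}$; (b) for every hyper-L $\mathcal{L}$ of $G_M$, $k(t\mathcal{L})=t(k(\mathcal{L})+n)-n$; (c) a set $\mathcal{H}$ of unit cubes is a minimum distance diagram of $G_M$ if and only if $t\mathcal{H}$ is a minimum distance diagram of $G_{tM}$; (d) $k(G_{tM})=t(k(G_M)+n)-n$.
   Context: For an integral nonsingular $n\times n$ matrix $A$, $G_A=\mathrm{Cay}(\mathbb{Z}^n/A\mathbb{Z}^n,\{e_1,\ldots,e_n\})$, where $e_1,\ldots,e_n$ is the canonical basis of $\mathbb{Z}^n$; $a\equiv b\pmod A$ means $a-b\in A\mathbb{Z}^n$. For $a\in\mathbb{Z}^n$, $[a]=[a_1,a_1+1)\times\cdots\times[a_n,a_n+1)\subset\mathbb{R}^n$ is a unit cube. $\mathbb{N}=\mathbb{Z}_{\geq0}$; $\leq$ on vectors is coordinatewise; for $a\in\mathbb{N}^n$, $\nabla(a)=\{[b]:0\leq b\leq a\}$. For a finite Abelian group $\Gamma=\langle\gamma_1,\ldots,\gamma_n\rangle$ of order $N$, let $\phi:\mathbb{N}^n\to\Gamma$, $\phi(a)=\sum a_i\gamma_i$. A hyper-L of $\mathrm{Cay}(\Gamma,\{\gamma_1,\ldots,\gamma_n\})$ is a set $\mathcal{L}$ of $N$ unit cubes $[a]$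 with $a\in\mathbb{N}^n$ such that (i) $\{\phi(a):[a]\in\mathcal{L}\}=\Gamma$ and (ii) $[a]\in\mathcal{L}\Rightarrow\nabla(a)\subset\mathcal{L}$. For $G_A$, $\Gamma=\mathbb{Z}^n/A\mathbb{Z}^n$ and $\phi(a)$ is the class of $a$. With $\|x\|=|x_1|+\cdots+|x_n|$, the diameter of a hyper-L is $k(\mathcal{L})=\max\{\|a\|:[a]\in\mathcal{L}\}$. A minimum distance diagram (MDD) is a hyper-L $\mathcal{H}$ such that $\|a\|=\min\{\|x\|: x\in\mathbb{N}^n,\ \phi(x)=\phi(a)\}$ for all $[a]\in\mathcal{H}$. $k(G)$ denotes the (directed) diameter of the Cayley digraph $G$. For an integer $t\geq1$, $t[a]=\{[ta+\alpha]:\alpha\in\mathbb{Z}^n,\ 0\leq\alpha_i\leq t-1\ \forall i\}$, and $t\mathcal{L}=\bigcup_{[a]\in\mathcal{L}}t[a]$. -}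

module Defs where

open import Level using (0ℓ)
open import Data.Nat as ℕ using (ℕ; zero; suc)
open import Data.Integer as ℤ using (ℤ; +_; ∣_∣; _≤_) renaming (_+_ to _+ℤ_; _*_ to _*ℤ_; _-_ to _-ℤ_; -_ to -ℤ_)
open import Data.Fin using (Fin; toℕ)
open import Data.Vec using (Vec; []; _∷_; map; zipWith; foldr; tabulate; removeAt; updateAt; lookup; replicate)
open import Data.Vec.Relation.Unary.All using (All)
open import Data.Vec.Relation.Binary.Pointwise.Inductive using (Pointwise)
open import Data.List as List using (List; length)
open import Data.List.Membership.Propositional using (_∈_)
open import Data.List.Relation.Unary.Unique.Propositional using (Unique)
open import Data.List.Relation.Unary.AllPairs using (AllPairs)
open import Data.Product using (Σ; ∃; _×_)
open import Relation.Binary.PropositionalEquality using (_≡_)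
open import Relation.Nullary using (¬_)
open import Function.Bundles using (_⇔_)

Vecℤ : ℕ → Set
Vecℤ n = Vec ℤ n

-- n×n integer matrices, as a vector of rows
Mat : ℕ → Set
Mat n = Vec (Vec ℤ n) n

sumℤ : ∀ {m} → Vec ℤ m → ℤ
sumℤ = foldr _ _+ℤ_ (+ 0)

_+ᵥ_ : ∀ {n} → Vecℤ n → Vecℤ n → Vecℤ n
_+ᵥ_ = zipWith _+ℤ_

_-ᵥ_ : ∀ {n} → Vecℤ n → Vecℤ n → Vecℤ n
_-ᵥ_ = zipWith _-ℤ_

_·ᵥ_ : ∀ {n} → ℤ → Vecℤ n → Vecℤ n
c ·ᵥ v = map (c *ℤ_) v

_⊛_ : ∀ {n} → Mat n → Vecℤ n → Vecℤ n
M ⊛ x = map (λ row → sumℤ (zipWith _*ℤ_ row x)) M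

_·ₘ_ : ∀ {n} → ℤ → Mat n → Mat n
c ·ₘ M = map (c ·ᵥ_) M

det : (n : ℕ) → Mat n → ℤ
det zero [] = + 1
det (suc n) (r ∷ rs) =
  sumℤ (tabulate (λ j → sign j *ℤ (lookup r j *ℤ det n (map (λ row → removeAt row j) rs))))
  where
  sign : Fin (suc n) → ℤ
  sign j = (-ℤ (+ 1)) ℤ.^ toℕ j

_≡_[mod_] : ∀ {n} → Vecℤ n → Vecℤ n → Mat n → Set
a ≡ b [mod M ] = ∃ λ x → a -ᵥ b ≡ M ⊛ x

Nonneg : ∀ {n} → Vecℤ n → Set
Nonneg = All (+ 0 ≤_)

_≤ᵥ_ : ∀ {n} → Vecℤ n → Vecℤ n → Set
_≤ᵥ_ = Pointwise _≤_

‖_‖ : ∀ {n} → Vecℤ n → ℕ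
‖ x ‖ = Data.Vec.sum (map ∣_∣ x)

-- a set of unit cubes [a], a ∈ ℤ^n (identified with the set of their corners a)
CubeSet : ℕ → Set₁
CubeSet n = Vecℤ n → Set

-- rs is a complete system of pairwise incongruent representatives of ℤ^n / Mℤ^n;
-- its length is the order N of the group
ResidueSystem : ∀ {n} → Mat n → List (Vecℤ n) → Set
ResidueSystem M rs = (∀ a → ∃ λ r → r ∈ rs × a ≡ r [mod M ])
                   × AllPairs (λ r s → ¬ (r ≡ s [mod M ])) rs

HasGroupOrder : ∀ {n} → Mat n → CubeSet n → Set
HasGroupOrder M L = ∃ λ ls → ∃ λ rs →
    (∀ a → L a ⇔ a ∈ ls) × Unique ls × ResidueSystem M rs × length ls ≡ length rs

HyperL : ∀ {n} → Mat n → CubeSet n → Set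
HyperL M L =
    (∀ a → L a → Nonneg a)
  × HasGroupOrder M L
  × (∀ g → ∃ λ a → L a × a ≡ g [mod M ])
  × (∀ a b → L a → Nonneg b → b ≤ᵥ a → L b)

MDD : ∀ {n} → Mat n → CubeSet n → Set
MDD M H = HyperL M H
  × (∀ a → H a → ∀ x → Nonneg x → x ≡ a [mod M ] → ‖ a ‖ ℕ.≤ ‖ x ‖)

IsDiameter : ∀ {n} → CubeSet n → ℕ → Set
IsDiameter L d = (∃ λ a → L a × ‖ a ‖ ≡ d) × (∀ a → L a → ‖ a ‖ ℕ.≤ d)

scale : ∀ {n} → ℕ → CubeSet n → CubeSet n
scale t L x = ∃ λ a → L a × ∃ λ α →
  All (λ αᵢ → (+ 0 ≤ αᵢ) × (αᵢ ≤ + t -ℤ + 1)) α × x ≡ ((+ t) ·ᵥ a) +ᵥ α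

-- Cayley digraph G_M: vertices are classes mod M (represented by vectors),
-- arcs v → v + e_i.  A walk is the list of generators used.
step : ∀ {n} → Vecℤ n → Fin n → Vecℤ n
step v i = updateAt v i (_+ℤ + 1)

walkEnd : ∀ {n} → Vecℤ n → List (Fin n) → Vecℤ n
walkEnd v List.[] = v
walkEnd v (i List.∷ w) = walkEnd (step v i) w

Walk : ∀ {n} → Mat n → Vecℤ n → List (Fin n) → Vecℤ n → Set
Walk M u w v = walkEnd u w ≡ v [mod M ]

IsDigraphDiameter : ∀ {n} → Mat n → ℕ → Set
IsDigraphDiameter M d =
    (∀ u v → ∃ λ w → Walk M u w v × length w ℕ.≤ d)
  × (∃ λ u → ∃ λ v → ∀ w → Walk M u w v → d ℕ.≤ length w)

module Submission where

-- Write t = t′ + 1. Every x ∈ ℤⁿ is uniquely t q + r with r in the box [0, t)ⁿ, the cubes of t[a]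
-- are exactly the points with quotient a, and x ≡ y (mod tM) iff x and y have the same remainder
-- and congruent quotients mod M. So tL is a complete system of representatives mod tM iff L is one
-- mod M, down-closedness transfers because division by t is monotone, and a nonnegative point has
-- norm t ‖q‖ + ‖r‖ with ‖r‖ ≤ n (t − 1), with equality at the far corner of the box. This gives
-- (a)–(c), and (d) by reading distances in G_M as norms of nonnegative representatives. That
-- k(G_M) exists at all uses det M ≠ 0: clearing the first row by column operations and inducting on
-- the minor gives B > 0 with B ℤⁿ ⊆ M ℤⁿ, so every class meets the box [0, B)ⁿ, congruence mod M is
-- decidable, and the diameter is found by a finite search.

open import Defs

module Lattices where

  open import Data.Empty using (⊥-elim)
  open import Data.Fin using (Fin; zero; suc; toℕ; punchIn; punchOut; inject₁; fromℕ<)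
  import Data.Fin.Properties as FinP
  open import Data.Integer as ℤ using (ℤ; +_; -[1+_]; _+_; _*_; _-_; -_; 0ℤ; 1ℤ; -1ℤ)
  open import Data.Integer.DivMod using (_/ℕ_; _%ℕ_; a≡a%ℕn+[a/ℕn]*n; n%ℕd<d; 0≤n⇒0≤n/ℕd)
  import Data.Integer.Properties as ℤP
  open import Algebra.Properties.AbelianGroup ℤP.+-0-abelianGroup using (∙-cancelˡ)
  open import Algebra.Properties.Semiring.Sum ℤP.+-*-semiring
    using (sum-syntax; ∑-distrib-+; *-distribˡ-sum; sum-cong-≗; sum-replicate-zero; sum-remove)
  open import Data.Integer.Tactic.RingSolver using (solve-∀)
  open import Data.List as List using (List; length; upTo; cartesianProductWith)
  open import Data.List.Membership.Propositional using (_∈_; find; lose)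
  open import Data.List.Membership.Propositional.Properties
    using (∈-cartesianProductWith⁺; ∈-cartesianProductWith⁻; ∈-map⁺; ∈-map⁻; ∈-upTo⁺; ∈-upTo⁻; ∈-lookup;
           ∈-deduplicate⁺; ∈-deduplicate⁻; deduplicate-∈⇔)
  import Data.List.Properties as ListP
  import Data.List.Relation.Unary.All as ListAll
  open import Data.List.Relation.Unary.All.Properties using (¬All⇒Any¬)
  open import Data.List.Relation.Unary.AllPairs as AllPairs using (AllPairs; []; _∷_)
  open import Data.List.Relation.Unary.Any as ListAny using (here; there; index)
  open import Data.List.Relation.Unary.Any.Properties using (lookup-index)
  open import Data.List.Relation.Unary.Unique.Propositional using (Unique)
  open import Data.Nat as ℕ using (ℕ; zero; suc; z≤n; s≤s)
  import Data.Nat.Properties as ℕP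
  open import Data.List.Extrema ℕP.≤-totalOrder using (argmax; argmax-all; f[xs]≤f[argmax])
  open import Data.Nat.Tactic.RingSolver using () renaming (solve-∀ to solveℕ-∀)
  open import Data.Product using (∃; _×_; _,_; proj₁; proj₂)
  open import Data.Product.Function.NonDependent.Propositional using (_×-⇔_)
  open import Data.Sum using (_⊎_; inj₁; inj₂; [_,_]′)
  open import Data.Vec as Vec using (Vec; []; _∷_; lookup; tabulate)
  open import Data.Vec.Functional using (updateAt)
  open import Data.Vec.Functional.Properties using (updateAt-updates; updateAt-minimal)
  import Data.Vec.Properties as VecP
  open import Data.Vec.Relation.Binary.Pointwise.Inductive using ([]; _∷_)
  open import Data.Vec.Relation.Unary.All as All using (All; []; _∷_)
  import Data.Vec.Relation.Unary.All.Properties as AllP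
  open import Function using (_∘_)
  open import Function.Bundles using (_⇔_; mk⇔; Equivalence)
  open import Function.Properties.Equivalence using (⇔-isEquivalence)
  open import Level using (0ℓ)
  open import Relation.Binary.Definitions using (DecidableEquality)
  open import Relation.Binary.PropositionalEquality
  open import Relation.Binary.Structures using (IsEquivalence)
  open import Relation.Nullary using (¬_; Dec; yes; no)
  open import Relation.Nullary.Decidable using (map′; _×-dec_)

  module ⇔ = IsEquivalence (⇔-isEquivalence {ℓ = 0ℓ})

  -- Determinants

  Matrix : ℕ → Set
  Matrix k = Fin k → Fin k → ℤ

  sign : ∀ {k} → Fin k → ℤ
  sign j = -1ℤ ℤ.^ toℕ j

  minor : ∀ {k} → Matrix (suc k) → Fin (suc k) → Matrix k
  minor A j i l = A (suc i) (punchIn j l)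

  det′ : (k : ℕ) → Matrix k → ℤ
  det′ zero    A = 1ℤ
  det′ (suc k) A = ∑[ j < suc k ] (sign j * (A zero j * det′ k (minor A j)))

  entries : ∀ {n} → Mat n → Matrix n
  entries M i l = lookup (lookup M i) l

  sumℤ-tabulate : ∀ {k} (f : Fin k → ℤ) → sumℤ (tabulate f) ≡ ∑[ j < k ] f j
  sumℤ-tabulate {zero}  f = refl
  sumℤ-tabulate {suc k} f = cong (_+_ (f zero)) (sumℤ-tabulate (f ∘ suc))

  det′-cong : ∀ k {A B : Matrix k} → (∀ i l → A i l ≡ B i l) → det′ k A ≡ det′ k B
  det′-cong zero    A≗B = refl
  det′-cong (suc k) A≗B = sum-cong-≗ λ j →
    cong₂ (λ a d → sign j * (a * d)) (A≗B zero j) (det′-cong k λ i l → A≗B (suc i) (punchIn j l))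

  lookup-removeAt : ∀ {n} {A : Set} (xs : Vec A (suc n)) i j → lookup (Vec.removeAt xs i) j ≡ lookup xs (punchIn i j)
  lookup-removeAt xs i j = begin
    lookup (Vec.removeAt xs i) j                 ≡⟨ cong (lookup (Vec.removeAt xs i)) (FinP.punchOut-punchIn i) ⟨
    lookup (Vec.removeAt xs i) (punchOut i≢iʲ)   ≡⟨ VecP.removeAt-punchOut xs i≢iʲ ⟩
    lookup xs (punchIn i j)                      ∎
    where
    open ≡-Reasoning
    i≢iʲ = FinP.punchInᵢ≢i i j ∘ sym

  det≡det′ : ∀ n (M : Mat n) → det n M ≡ det′ n (entries M)
  det≡det′ zero    []       = refl
  det≡det′ (suc n) (r ∷ rs) = trans (sumℤ-tabulate λ j → sign j * (lookup r j * det n (minorRows j)))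
    (sum-cong-≗ λ j → cong (λ d → sign j * (lookup r j * d))
      (trans (det≡det′ n (minorRows j)) (det′-cong n (minorRows-entries j))))
    where
    minorRows : Fin (suc n) → Mat n
    minorRows j = Vec.map (λ row → Vec.removeAt row j) rs
    minorRows-entries : ∀ j i l → entries (minorRows j) i l ≡ minor (entries (r ∷ rs)) j i l
    minorRows-entries j i l =
      trans (cong (λ v → lookup v l) (VecP.lookup-map i (λ row → Vec.removeAt row j) rs)) (lookup-removeAt (lookup rs i) j l)

  ∑-update : ∀ {k} (p : Fin k) (f g : Fin k → ℤ) (e : ℤ) →
    (∀ j → j ≢ p → f j ≡ g j) → f p ≡ g p + e → ∑[ j < k ] f j ≡ ∑[ j < k ] g j + e
  ∑-update {suc k} p f g e f≗g fp = begin
    ∑[ j < suc k ] f j                     ≡⟨ sum-remove {i = p} f ⟩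
    f p + rest f                           ≡⟨ cong₂ _+_ fp (sum-cong-≗ λ j → f≗g _ (FinP.punchInᵢ≢i p j)) ⟩
    g p + e + rest g                       ≡⟨ swap (g p) e (rest g) ⟩
    g p + rest g + e                       ≡⟨ cong (_+ e) (sum-remove {i = p} g) ⟨
    ∑[ j < suc k ] g j + e                 ∎
    where
    open ≡-Reasoning
    rest : (Fin (suc k) → ℤ) → ℤ
    rest h = ∑[ j < k ] h (punchIn p j)
    swap : ∀ a b c → a + b + c ≡ a + c + b
    swap = solve-∀

  ∑-adjacent-pair : ∀ {k} (a : Fin k) (f : Fin (suc k) → ℤ) →
    (∀ j → j ≢ inject₁ a → j ≢ suc a → f j ≡ 0ℤ) → f (inject₁ a) + f (suc a) ≡ 0ℤ →
    ∑[ j < suc k ] f j ≡ 0ℤ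
  ∑-adjacent-pair {suc k} zero f rest pair = begin
    f zero + (f (suc zero) + ∑[ j < k ] f (suc (suc j)))  ≡⟨ cong (λ s → f zero + (f (suc zero) + s)) others ⟩
    f zero + (f (suc zero) + 0ℤ)                           ≡⟨ cong (_+_ (f zero)) (ℤP.+-identityʳ _) ⟩
    f zero + f (suc zero)                                  ≡⟨ pair ⟩
    0ℤ                                                     ∎
    where
    open ≡-Reasoning
    others : ∑[ j < k ] f (suc (suc j)) ≡ 0ℤ
    others = trans (sum-cong-≗ λ j → rest (suc (suc j)) (λ ()) (λ ())) (sum-replicate-zero k)
  ∑-adjacent-pair {suc k} (suc a) f rest pair =
    trans (cong (_+ ∑[ j < suc k ] f (suc j)) (rest zero (λ ()) (λ ()))) (trans (ℤP.+-identityˡ _)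
      (∑-adjacent-pair a (f ∘ suc) (λ j p q → rest (suc j) (p ∘ FinP.suc-injective) (q ∘ FinP.suc-injective)) pair))

  det′-minor-cong : ∀ k {A B : Matrix (suc k)} b → (∀ i l → l ≢ b → A i l ≡ B i l) →
    det′ k (minor A b) ≡ det′ k (minor B b)
  det′-minor-cong k b A≗B = det′-cong k λ i l → A≗B (suc i) (punchIn b l) (FinP.punchInᵢ≢i b l)

  punchIn≡⇒≡punchOut : ∀ {k} {j b : Fin (suc k)} {l} (j≢b : j ≢ b) → punchIn j l ≡ b → l ≡ punchOut j≢b
  punchIn≡⇒≡punchOut {j = j} j≢b refl = sym (trans (FinP.punchOut-cong j refl) (FinP.punchOut-punchIn j))

  det′-linear : ∀ k (A B C : Matrix k) (b : Fin k) (u c : ℤ) →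
    (∀ i l → l ≢ b → A i l ≡ B i l) → (∀ i l → l ≢ b → A i l ≡ C i l) →
    (∀ i → A i b ≡ u * B i b + c * C i b) → det′ k A ≡ u * det′ k B + c * det′ k C
  det′-linear (suc k) A B C b u c A≗B A≗C Ab = begin
    ∑[ j < suc k ] term A j                                          ≡⟨ sum-cong-≗ split ⟩
    ∑[ j < suc k ] (u * term B j + c * term C j)                     ≡⟨ ∑-distrib-+ (λ j → u * term B j) (λ j → c * term C j) ⟩
    ∑[ j < suc k ] (u * term B j) + ∑[ j < suc k ] (c * term C j)    ≡⟨ cong₂ _+_ (*-distribˡ-sum u (term B)) (*-distribˡ-sum c (term C)) ⟨
    u * det′ (suc k) B + c * det′ (suc k) C                          ∎
    where
    open ≡-Reasoning
    term : Matrix (suc k) → Fin (suc k) → ℤ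
    term X j = sign j * (X zero j * det′ k (minor X j))
    split : ∀ j → term A j ≡ u * term B j + c * term C j
    split j with j FinP.≟ b
    ... | yes refl
      rewrite Ab zero | det′-minor-cong k j A≗B | det′-minor-cong k j (λ i l l≢j → trans (sym (A≗C i l l≢j)) (A≗B i l l≢j))
      = ring u c (sign j) (B zero j) (C zero j) (det′ k (minor B j))
      where
      ring : ∀ u c s x y d → s * ((u * x + c * y) * d) ≡ u * (s * (x * d)) + c * (s * (y * d))
      ring = solve-∀
    ... | no j≢b
      rewrite sym (A≗B zero j j≢b) | sym (A≗C zero j j≢b)
            | det′-linear k (minor A j) (minor B j) (minor C j) (punchOut j≢b) u c
                (λ i l l≢ → A≗B (suc i) (punchIn j l) (l≢ ∘ punchIn≡⇒≡punchOut j≢b))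
                (λ i l l≢ → A≗C (suc i) (punchIn j l) (l≢ ∘ punchIn≡⇒≡punchOut j≢b))
                (λ i → subst (λ l → A (suc i) l ≡ u * B (suc i) l + c * C (suc i) l)
                             (sym (FinP.punchIn-punchOut j≢b)) (Ab (suc i)))
      = ring u c (sign j) (A zero j) (det′ k (minor B j)) (det′ k (minor C j))
      where
      ring : ∀ u c s x d e → s * (x * (u * d + c * e)) ≡ u * (s * (x * d)) + c * (s * (x * e))
      ring = solve-∀

  punchIn-adjacent : ∀ {k} (a l : Fin k) →
    punchIn (inject₁ a) l ≡ punchIn (suc a) l ⊎ (punchIn (inject₁ a) l ≡ suc a × punchIn (suc a) l ≡ inject₁ a)
  punchIn-adjacent zero    zero    = inj₂ (refl , refl)
  punchIn-adjacent zero    (suc l) = inj₁ refl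
  punchIn-adjacent (suc a) zero    = inj₁ refl
  punchIn-adjacent (suc a) (suc l) with punchIn-adjacent a l
  ... | inj₁ e         = inj₁ (cong suc e)
  ... | inj₂ (e₁ , e₂) = inj₂ (cong suc e₁ , cong suc e₂)

  punchIn-preserves-adjacent : ∀ {k} (j : Fin (suc (suc k))) (a : Fin (suc k)) → j ≢ inject₁ a → j ≢ suc a →
    ∃ λ a′ → punchIn j (inject₁ a′) ≡ inject₁ a × punchIn j (suc a′) ≡ suc a
  punchIn-preserves-adjacent zero             zero    j≢a _    = ⊥-elim (j≢a refl)
  punchIn-preserves-adjacent zero             (suc a) _   _    = a , refl , refl
  punchIn-preserves-adjacent (suc zero)       zero    _   j≢a₁ = ⊥-elim (j≢a₁ refl)
  punchIn-preserves-adjacent {suc k} (suc (suc j)) zero _ _ = zero , refl , refl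
  punchIn-preserves-adjacent {suc k} (suc j)  (suc a) j≢a j≢a₁
    with punchIn-preserves-adjacent j a (j≢a ∘ cong suc) (j≢a₁ ∘ cong suc)
  ... | a′ , e₁ , e₂ = suc a′ , cong suc e₁ , cong suc e₂

  sign-suc : ∀ {k} (a : Fin k) → sign (suc a) ≡ - sign (inject₁ a)
  sign-suc a rewrite FinP.toℕ-inject₁ a = ℤP.-1*i≡-i (sign a)

  det′-adjacent-equal-columns : ∀ k (A : Matrix (suc k)) (a : Fin k) →
    (∀ i → A i (inject₁ a) ≡ A i (suc a)) → det′ (suc k) A ≡ 0ℤ
  det′-adjacent-equal-columns (suc k) A a equal = ∑-adjacent-pair a term vanish cancel
    where
    term : Fin (suc (suc k)) → ℤ
    term j = sign j * (A zero j * det′ (suc k) (minor A j))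
    vanish : ∀ j → j ≢ inject₁ a → j ≢ suc a → term j ≡ 0ℤ
    vanish j j≢a j≢a₁ with punchIn-preserves-adjacent j a j≢a j≢a₁
    ... | a′ , e₁ , e₂
      rewrite det′-adjacent-equal-columns k (minor A j) a′
                (λ i → trans (cong (A (suc i)) e₁) (trans (equal (suc i)) (cong (A (suc i)) (sym e₂))))
      = trans (cong (sign j *_) (ℤP.*-zeroʳ (A zero j))) (ℤP.*-zeroʳ (sign j))
    same-minor : ∀ i l → minor A (inject₁ a) i l ≡ minor A (suc a) i l
    same-minor i l with punchIn-adjacent a l
    ... | inj₁ e         = cong (A (suc i)) e
    ... | inj₂ (e₁ , e₂) rewrite e₁ | e₂ = sym (equal (suc i))
    cancel : term (inject₁ a) + term (suc a) ≡ 0ℤ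
    cancel rewrite sign-suc a | equal zero | det′-cong (suc k) (same-minor) =
      ring (sign (inject₁ a)) (A zero (suc a)) (det′ (suc k) (minor A (suc a)))
      where
      ring : ∀ s x d → s * (x * d) + - s * (x * d) ≡ 0ℤ
      ring = solve-∀

  inject₁≢suc : ∀ {k} (p : Fin k) → inject₁ p ≢ suc p
  inject₁≢suc zero    ()
  inject₁≢suc (suc p) e = inject₁≢suc p (FinP.suc-injective e)

  infixl 7 _⊙_
  _⊙_ : ∀ {k} → Matrix k → (Fin k → ℤ) → Fin k → ℤ
  _⊙_ {k} A x i = ∑[ l < k ] (A i l * x l)

  infix 4 _⊑_
  _⊑_ : ∀ {k} → Matrix k → Matrix k → Set
  N ⊑ A = ∀ x → ∃ λ x′ → ∀ i → (N ⊙ x) i ≡ (A ⊙ x′) i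

  ⊑-refl : ∀ {k} (A : Matrix k) → A ⊑ A
  ⊑-refl A x = x , λ _ → refl

  ⊑-trans : ∀ {k} {A B C : Matrix k} → A ⊑ B → B ⊑ C → A ⊑ C
  ⊑-trans A⊑B B⊑C x with A⊑B x
  ... | y , Ax≡By with B⊑C y
  ... | z , By≡Cz = z , λ i → trans (Ax≡By i) (By≡Cz i)

  scaleColumn : ∀ {k} → Matrix k → Fin k → ℤ → Matrix k
  scaleColumn A b u i = updateAt (A i) b (u *_)

  addColumn : ∀ {k} → Matrix k → Fin k → ℤ → Fin k → Matrix k
  addColumn A b c a i = updateAt (A i) b (_+ c * A i a)

  det′-scaleColumn : ∀ k (A : Matrix k) b u → det′ k (scaleColumn A b u) ≡ u * det′ k A
  det′-scaleColumn k A b u =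
    trans (det′-linear k (scaleColumn A b u) A A b u 0ℤ
            (λ i l l≢b → updateAt-minimal l b (A i) l≢b) (λ i l l≢b → updateAt-minimal l b (A i) l≢b)
            (λ i → trans (updateAt-updates b (A i)) (sym (ℤP.+-identityʳ _))))
          (ℤP.+-identityʳ _)

  Adjacent : ∀ {k} → Fin k → Fin (suc k) → Fin (suc k) → Set
  Adjacent p b a = (b ≡ inject₁ p × a ≡ suc p) ⊎ (b ≡ suc p × a ≡ inject₁ p)

  copyColumn-adjacent : ∀ {k} (A : Matrix (suc k)) (p : Fin k) b a → Adjacent p b a →
    ∀ i → updateAt (A i) b (λ _ → A i a) (inject₁ p) ≡ updateAt (A i) b (λ _ → A i a) (suc p)
  copyColumn-adjacent A p _ _ (inj₁ (refl , refl)) i =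
    trans (updateAt-updates (inject₁ p) (A i)) (sym (updateAt-minimal (suc p) (inject₁ p) (A i) (inject₁≢suc p ∘ sym)))
  copyColumn-adjacent A p _ _ (inj₂ (refl , refl)) i =
    trans (updateAt-minimal (inject₁ p) (suc p) (A i) (inject₁≢suc p)) (sym (updateAt-updates (suc p) (A i)))

  det′-addColumn : ∀ k (A : Matrix (suc k)) (p : Fin k) b c a → Adjacent p b a →
    det′ (suc k) (addColumn A b c a) ≡ det′ (suc k) A
  det′-addColumn k A p b c a adjacent = begin
    det′ (suc k) (addColumn A b c a)          ≡⟨ linear ⟩
    1ℤ * det′ (suc k) A + c * det′ (suc k) C  ≡⟨ cong (λ d → 1ℤ * det′ (suc k) A + c * d) (det′-adjacent-equal-columns k C p equal) ⟩
    1ℤ * det′ (suc k) A + c * 0ℤ              ≡⟨ ring (det′ (suc k) A) c ⟩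
    det′ (suc k) A                            ∎
    where
    open ≡-Reasoning
    C : Matrix (suc k)
    C i = updateAt (A i) b (λ _ → A i a)
    equal : ∀ i → C i (inject₁ p) ≡ C i (suc p)
    equal = copyColumn-adjacent A p b a adjacent
    linear : det′ (suc k) (addColumn A b c a) ≡ 1ℤ * det′ (suc k) A + c * det′ (suc k) C
    linear = det′-linear (suc k) (addColumn A b c a) A C b 1ℤ c
      (λ i l l≢b → updateAt-minimal l b (A i) l≢b)
      (λ i l l≢b → trans (updateAt-minimal l b (A i) l≢b) (sym (updateAt-minimal l b (A i) l≢b)))
      (λ i → trans (updateAt-updates b (A i))
               (cong₂ _+_ (sym (ℤP.*-identityˡ (A i b))) (cong (c *_) (sym (updateAt-updates b {λ _ → A i a} (A i))))))
    ring : ∀ d c → 1ℤ * d + c * 0ℤ ≡ d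
    ring = solve-∀

  scaleColumn-⊑ : ∀ {k} (A : Matrix k) b u → scaleColumn A b u ⊑ A
  scaleColumn-⊑ A b u x = updateAt x b (u *_) , λ i → sum-cong-≗ λ l → termwise i l
    where
    termwise : ∀ i l → scaleColumn A b u i l * x l ≡ A i l * updateAt x b (u *_) l
    termwise i l with l FinP.≟ b
    ... | yes refl = trans (cong (_* x l) (updateAt-updates l (A i)))
                       (trans (ring u (A i l) (x l)) (cong (A i l *_) (sym (updateAt-updates l x))))
      where
      ring : ∀ u a y → u * a * y ≡ a * (u * y)
      ring = solve-∀
    ... | no l≢b = cong₂ _*_ (updateAt-minimal l b (A i) l≢b) (sym (updateAt-minimal l b x l≢b))

  addColumn-⊑ : ∀ {k} (A : Matrix k) b c a → a ≢ b → addColumn A b c a ⊑ A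
  addColumn-⊑ {k} A b c a a≢b x = x′ , λ i → trans (viaColumn i) (sym (viaCoefficient i))
    where
    x′ = updateAt x a (_+ c * x b)
    δ : Fin k → ℤ
    δ i = c * A i a * x b
    viaColumn : ∀ i → (addColumn A b c a ⊙ x) i ≡ (A ⊙ x) i + δ i
    viaColumn i = ∑-update b _ _ (δ i)
      (λ l l≢b → cong (_* x l) (updateAt-minimal l b (A i) l≢b))
      (trans (cong (_* x b) (updateAt-updates b (A i))) (ring (A i b) c (A i a) (x b)))
      where
      ring : ∀ y c z w → (y + c * z) * w ≡ y * w + c * z * w
      ring = solve-∀
    viaCoefficient : ∀ i → (A ⊙ x′) i ≡ (A ⊙ x) i + δ i
    viaCoefficient i = ∑-update a _ _ (δ i)
      (λ l l≢a → cong (A i l *_) (updateAt-minimal l a x l≢a))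
      (trans (cong (A i a *_) (updateAt-updates a x)) (ring (A i a) (x a) c (x b)))
      where
      ring : ∀ z y c w → z * (y + c * w) ≡ z * y + c * z * w
      ring = solve-∀

  -- Column operations may multiply the determinant by any nonzero factor: this is what lets the first
  -- row be cleared without a gcd computation.
  record Reduction {k} (A N : Matrix k) : Set where
    field
      det≢0 : det′ k A ≢ 0ℤ → det′ k N ≢ 0ℤ
      ⊑A    : N ⊑ A

  reduction-refl : ∀ {k} (A : Matrix k) → Reduction A A
  reduction-refl A = record { det≢0 = λ d≢0 → d≢0 ; ⊑A = ⊑-refl A }

  reduction-trans : ∀ {k} {A B C : Matrix k} → Reduction A B → Reduction B C → Reduction A C
  reduction-trans {A = A} {B} {C} AB BC = record
    { det≢0 = Reduction.det≢0 BC ∘ Reduction.det≢0 AB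
    ; ⊑A    = ⊑-trans {A = C} {B} {A} (Reduction.⊑A BC) (Reduction.⊑A AB) }

  scaleColumn-reduction : ∀ {k} (A : Matrix k) b {u} → u ≢ 0ℤ → Reduction A (scaleColumn A b u)
  scaleColumn-reduction {k} A b {u} u≢0 = record
    { det≢0 = λ d≢0 → [ u≢0 , d≢0 ]′ ∘ ℤP.i*j≡0⇒i≡0∨j≡0 u ∘ trans (sym (det′-scaleColumn k A b u))
    ; ⊑A    = scaleColumn-⊑ A b u }

  addColumn-reduction : ∀ {k} (A : Matrix (suc k)) (p : Fin k) b c a → Adjacent p b a →
    Reduction A (addColumn A b c a)
  addColumn-reduction {k} A p b c a adjacent = record
    { det≢0 = λ d≢0 → d≢0 ∘ trans (sym (det′-addColumn k A p b c a adjacent))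
    ; ⊑A    = addColumn-⊑ A b c a a≢b }
    where
    a≢b : a ≢ b
    a≢b a≡b = [ (λ (b≡ , a≡) → inject₁≢suc p (trans (sym b≡) (trans (sym a≡b) a≡)))
              , (λ (b≡ , a≡) → inject₁≢suc p (trans (sym a≡) (trans a≡b b≡))) ]′ adjacent

  module FirstRowElimination {k : ℕ} (p : Fin k) where

    c₁ c₂ : Fin (suc k)
    c₁ = inject₁ p
    c₂ = suc p

    record Step (A N : Matrix (suc k)) : Set where
      field
        reduction : Reduction A N
        row       : ∀ l → l ≢ c₁ → l ≢ c₂ → N zero l ≡ A zero l

    step-trans : ∀ {A B C} → Step A B → Step B C → Step A C
    step-trans AB BC = record
      { reduction = reduction-trans (Step.reduction AB) (Step.reduction BC)
      ; row       = λ l l≢c₁ l≢c₂ → trans (Step.row BC l l≢c₁ l≢c₂) (Step.row AB l l≢c₁ l≢c₂) }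

    scale₂ : ∀ A {u} → u ≢ 0ℤ → Step A (scaleColumn A c₂ u)
    scale₂ A u≢0 = record
      { reduction = scaleColumn-reduction A c₂ u≢0
      ; row       = λ l _ l≢c₂ → updateAt-minimal l c₂ (A zero) l≢c₂ }

    add₁ : ∀ A c → Step A (addColumn A c₁ c c₂)
    add₁ A c = record
      { reduction = addColumn-reduction A p c₁ c c₂ (inj₁ (refl , refl))
      ; row       = λ l l≢c₁ _ → updateAt-minimal l c₁ (A zero) l≢c₁ }

    add₂ : ∀ A c → Step A (addColumn A c₂ c c₁)
    add₂ A c = record
      { reduction = addColumn-reduction A p c₂ c c₁ (inj₂ (refl , refl))
      ; row       = λ l _ l≢c₂ → updateAt-minimal l c₂ (A zero) l≢c₂ }

    eliminate-with-pivot : ∀ A → A zero c₁ ≢ 0ℤ → ∃ λ N → Step A N × N zero c₂ ≡ 0ℤ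
    eliminate-with-pivot A a≢0 = N , step-trans (scale₂ A a≢0) (add₂ A₁ (- b)) , cleared
      where
      a = A zero c₁
      b = A zero c₂
      A₁ = scaleColumn A c₂ a
      N = addColumn A₁ c₂ (- b) c₁
      cleared : N zero c₂ ≡ 0ℤ
      cleared = begin
        N zero c₂                      ≡⟨ updateAt-updates c₂ (A₁ zero) ⟩
        A₁ zero c₂ + - b * A₁ zero c₁  ≡⟨ cong₂ (λ x y → x + - b * y) (updateAt-updates c₂ (A zero))
                                              (updateAt-minimal c₁ c₂ (A zero) (inject₁≢suc p)) ⟩
        a * b + - b * a                ≡⟨ ring a b ⟩
        0ℤ                             ∎
        where
        open ≡-Reasoning
        ring : ∀ a b → a * b + - b * a ≡ 0ℤ
        ring = solve-∀

    eliminate : ∀ A → ∃ λ N → Step A N × N zero c₂ ≡ 0ℤ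
    eliminate A with A zero c₂ ℤP.≟ 0ℤ | A zero c₁ ℤP.≟ 0ℤ
    ... | yes b≡0 | _       = A , record { reduction = reduction-refl A ; row = λ _ _ _ → refl } , b≡0
    ... | no _    | no a≢0  = eliminate-with-pivot A a≢0
    ... | no b≢0  | yes a≡0 with eliminate-with-pivot (addColumn A c₁ 1ℤ c₂) pivot
      where
      pivot : addColumn A c₁ 1ℤ c₂ zero c₁ ≢ 0ℤ
      pivot e = b≢0 (begin
        A zero c₂                     ≡⟨ ℤP.*-identityˡ _ ⟨
        1ℤ * A zero c₂                ≡⟨ ℤP.+-identityˡ _ ⟨
        0ℤ + 1ℤ * A zero c₂           ≡⟨ cong (_+ 1ℤ * A zero c₂) a≡0 ⟨
        A zero c₁ + 1ℤ * A zero c₂    ≡⟨ updateAt-updates c₁ (A zero) ⟨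
        addColumn A c₁ 1ℤ c₂ zero c₁  ≡⟨ e ⟩
        0ℤ                            ∎)
        where open ≡-Reasoning
    ... | N , step , cleared = N , step-trans (add₁ A 1ℤ) step , cleared

  clearFirstRow-beyond : ∀ {k} m → m ℕ.≤ k → (A : Matrix (suc k)) → (∀ l → m ℕ.< toℕ l → A zero l ≡ 0ℤ) →
    ∃ λ N → Reduction A N × (∀ l → l ≢ zero → N zero l ≡ 0ℤ)
  clearFirstRow-beyond zero _ A cleared = A , reduction-refl A , λ
    { zero 0≢0 → ⊥-elim (0≢0 refl)
    ; (suc l) _ → cleared (suc l) (s≤s z≤n) }
  clearFirstRow-beyond {k} (suc m) m<k A cleared
    with FirstRowElimination.eliminate (fromℕ< m<k) A
  ... | A′ , step , cleared₂ with clearFirstRow-beyond m (ℕP.<⇒≤ m<k) A′ cleared′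
    where
    open FirstRowElimination (fromℕ< m<k)
    toℕp≡m : toℕ (fromℕ< m<k) ≡ m
    toℕp≡m = FinP.toℕ-fromℕ< m<k
    cleared′ : ∀ l → m ℕ.< toℕ l → A′ zero l ≡ 0ℤ
    cleared′ l m<l with ℕP.m≤n⇒m<n∨m≡n m<l
    ... | inj₂ 1+m≡l = subst (λ j → A′ zero j ≡ 0ℤ) (FinP.toℕ-injective (trans (cong suc toℕp≡m) 1+m≡l)) cleared₂
    ... | inj₁ 1+m<l = trans (Step.row step l l≢c₁ l≢c₂) (cleared l 1+m<l)
      where
      l≢c₁ : l ≢ c₁
      l≢c₁ refl = ℕP.<-irrefl (sym (trans (FinP.toℕ-inject₁ (fromℕ< m<k)) toℕp≡m)) (ℕP.<-trans (ℕP.n<1+n m) 1+m<l)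
      l≢c₂ : l ≢ c₂
      l≢c₂ refl = ℕP.<-irrefl (sym (cong suc toℕp≡m)) 1+m<l
  ... | N , A′N , clearedN = N , reduction-trans (FirstRowElimination.Step.reduction step) A′N , clearedN

  clearFirstRow : ∀ {k} (A : Matrix (suc k)) → ∃ λ N → Reduction A N × (∀ l → l ≢ zero → N zero l ≡ 0ℤ)
  clearFirstRow {k} A = clearFirstRow-beyond k ℕP.≤-refl A
    (λ l k<l → ⊥-elim (ℕP.<⇒≱ k<l (ℕ.s≤s⁻¹ (FinP.toℕ<n l))))

  det′-first-row : ∀ k (N : Matrix (suc k)) → (∀ l → l ≢ zero → N zero l ≡ 0ℤ) →
    det′ (suc k) N ≡ N zero zero * det′ k (minor N zero)
  det′-first-row k N cleared = begin
    1ℤ * g·d + ∑[ j < k ] term (suc j)  ≡⟨ cong (_+_ (1ℤ * g·d)) rest≡0 ⟩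
    1ℤ * g·d + 0ℤ                      ≡⟨ ℤP.+-identityʳ (1ℤ * g·d) ⟩
    1ℤ * g·d                           ≡⟨ ℤP.*-identityˡ g·d ⟩
    g·d                                ∎
    where
    open ≡-Reasoning
    g·d = N zero zero * det′ k (minor N zero)
    term : Fin (suc k) → ℤ
    term j = sign j * (N zero j * det′ k (minor N j))
    vanish : ∀ j → term (suc j) ≡ 0ℤ
    vanish j rewrite cleared (suc j) (λ ()) | ℤP.*-zeroˡ (det′ k (minor N (suc j))) = ℤP.*-zeroʳ (sign (suc j))
    rest≡0 : ∑[ j < k ] term (suc j) ≡ 0ℤ
    rest≡0 = trans (sum-cong-≗ vanish) (sum-replicate-zero k)

  *≢0⇒factors≢0 : ∀ i j → i * j ≢ 0ℤ → i ≢ 0ℤ × j ≢ 0ℤ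
  *≢0⇒factors≢0 i j ij≢0 = (λ i≡0 → ij≢0 (trans (cong (_* j) i≡0) (ℤP.*-zeroˡ j)))
                          , (λ j≡0 → ij≢0 (trans (cong (i *_) j≡0) (ℤP.*-zeroʳ i)))

  -- x₀ = D′ y₀, and the other coordinates solve the minor for g yᵢ − Nᵢ₀ y₀
  back-substitution : ∀ k (N : Matrix (suc k)) D′ → (∀ l → l ≢ zero → N zero l ≡ 0ℤ) →
    (∀ (z : Fin k → ℤ) → ∃ λ x → ∀ i → (minor N zero ⊙ x) i ≡ D′ * z i) →
    ∀ (y : Fin (suc k) → ℤ) → ∃ λ x → ∀ i → (N ⊙ x) i ≡ N zero zero * D′ * y i
  back-substitution k N D′ cleared solveMinor y = x , row
    where
    g = N zero zero
    rest : ∃ λ z → ∀ i → (minor N zero ⊙ z) i ≡ D′ * (g * y (suc i) - N (suc i) zero * y zero)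
    rest = solveMinor (λ i → g * y (suc i) - N (suc i) zero * y zero)
    x : Fin (suc k) → ℤ
    x zero    = D′ * y zero
    x (suc l) = proj₁ rest l
    row : ∀ i → (N ⊙ x) i ≡ g * D′ * y i
    row zero = begin
      g * (D′ * y zero) + ∑[ l < k ] (N zero (suc l) * x (suc l))  ≡⟨ cong (_+_ (g * (D′ * y zero))) others ⟩
      g * (D′ * y zero) + 0ℤ                                      ≡⟨ ring g D′ (y zero) ⟩
      g * D′ * y zero                                             ∎
      where
      open ≡-Reasoning
      others : ∑[ l < k ] (N zero (suc l) * x (suc l)) ≡ 0ℤ
      others = trans (sum-cong-≗ λ l → trans (cong (_* x (suc l)) (cleared (suc l) (λ ()))) (ℤP.*-zeroˡ (x (suc l))))
                     (sum-replicate-zero k)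
      ring : ∀ g d y → g * (d * y) + 0ℤ ≡ g * d * y
      ring = solve-∀
    row (suc i) = trans (cong (_+_ (N (suc i) zero * (D′ * y zero))) (proj₂ rest i))
                        (ring g D′ (y zero) (y (suc i)) (N (suc i) zero))
      where
      ring : ∀ g d y₀ yᵢ c → c * (d * y₀) + d * (g * yᵢ - c * y₀) ≡ g * d * yᵢ
      ring = solve-∀

  det′≢0⇒multiples-in-lattice : ∀ k (A : Matrix k) → det′ k A ≢ 0ℤ →
    ∃ λ D → D ≢ 0ℤ × ∀ (y : Fin k → ℤ) → ∃ λ x → ∀ i → (A ⊙ x) i ≡ D * y i
  det′≢0⇒multiples-in-lattice zero    A _ = 1ℤ , (λ ()) , λ y → (λ ()) , λ ()
  det′≢0⇒multiples-in-lattice (suc k) A detA≢0 with clearFirstRow A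
  ... | N , A⇝N , cleared
    with *≢0⇒factors≢0 (N zero zero) (det′ k (minor N zero))
           (subst (_≢ 0ℤ) (det′-first-row k N cleared) (Reduction.det≢0 A⇝N detA≢0))
  ... | g≢0 , minor≢0 with det′≢0⇒multiples-in-lattice k (minor N zero) minor≢0
  ... | D′ , D′≢0 , solveMinor = N zero zero * D′ , [ g≢0 , D′≢0 ]′ ∘ ℤP.i*j≡0⇒i≡0∨j≡0 (N zero zero) , solution
    where
    solution : ∀ y → ∃ λ x → ∀ i → (A ⊙ x) i ≡ N zero zero * D′ * y i
    solution y with back-substitution k N D′ cleared solveMinor y
    ... | x , Nx≡ with Reduction.⊑A A⇝N x
    ...   | x′ , Nx≡Ax′ = x′ , λ i → trans (sym (Nx≡Ax′ i)) (Nx≡ i)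

  -- Integer vectors

  0ᵥ : ∀ n → Vecℤ n
  0ᵥ n = Vec.replicate n 0ℤ

  norm-0ᵥ : ∀ n → ‖ 0ᵥ n ‖ ≡ 0
  norm-0ᵥ zero    = refl
  norm-0ᵥ (suc n) = norm-0ᵥ n

  0ᵥ-nonneg : ∀ n → Nonneg (0ᵥ n)
  0ᵥ-nonneg zero    = []
  0ᵥ-nonneg (suc n) = ℤ.+≤+ z≤n ∷ 0ᵥ-nonneg n

  ≡-by-lookup : ∀ {A : Set} {n} {u v : Vec A n} → (∀ i → lookup u i ≡ lookup v i) → u ≡ v
  ≡-by-lookup {u = u} {v} u≗v =
    trans (sym (VecP.tabulate∘lookup u)) (trans (VecP.tabulate-cong u≗v) (VecP.tabulate∘lookup v))

  +ᵥ-identityʳ : ∀ {n} (v : Vecℤ n) → v +ᵥ 0ᵥ n ≡ v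
  +ᵥ-identityʳ = VecP.zipWith-identityʳ ℤP.+-identityʳ

  +ᵥ-comm : ∀ {n} (u v : Vecℤ n) → u +ᵥ v ≡ v +ᵥ u
  +ᵥ-comm = VecP.zipWith-comm ℤP.+-comm

  ·ᵥ-·ᵥ : ∀ {n} c d (v : Vecℤ n) → c ·ᵥ (d ·ᵥ v) ≡ (c * d) ·ᵥ v
  ·ᵥ-·ᵥ c d v = trans (sym (VecP.map-∘ (c *_) (d *_) v)) (VecP.map-cong (λ x → sym (ℤP.*-assoc c d x)) v)

  -ᵥ-self : ∀ {n} (a : Vecℤ n) → a -ᵥ a ≡ 0ᵥ n
  -ᵥ-self []      = refl
  -ᵥ-self (x ∷ a) = cong₂ _∷_ (ℤP.+-inverseʳ x) (-ᵥ-self a)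

  -ᵥ-anticomm : ∀ {n} (a b : Vecℤ n) → b -ᵥ a ≡ -1ℤ ·ᵥ (a -ᵥ b)
  -ᵥ-anticomm []      []      = refl
  -ᵥ-anticomm (x ∷ a) (y ∷ b) = cong₂ _∷_ (ring x y) (-ᵥ-anticomm a b)
    where
    ring : ∀ x y → y - x ≡ -1ℤ * (x - y)
    ring = solve-∀

  -ᵥ-telescope : ∀ {n} (a b c : Vecℤ n) → a -ᵥ c ≡ (a -ᵥ b) +ᵥ (b -ᵥ c)
  -ᵥ-telescope []      []      []      = refl
  -ᵥ-telescope (x ∷ a) (y ∷ b) (z ∷ c) = cong₂ _∷_ (ring x y z) (-ᵥ-telescope a b c)
    where
    ring : ∀ x y z → x - z ≡ x - y + (y - z)
    ring = solve-∀

  -ᵥ-affine : ∀ {n} c (a b r : Vecℤ n) → ((c ·ᵥ a) +ᵥ r) -ᵥ ((c ·ᵥ b) +ᵥ r) ≡ c ·ᵥ (a -ᵥ b)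
  -ᵥ-affine c []      []      []      = refl
  -ᵥ-affine c (x ∷ a) (y ∷ b) (z ∷ r) = cong₂ _∷_ (ring c x y z) (-ᵥ-affine c a b r)
    where
    ring : ∀ c x y z → c * x + z - (c * y + z) ≡ c * (x - y)
    ring = solve-∀

  +ᵥ-·ᵥ-interchange : ∀ {n} c (q r w : Vecℤ n) → ((c ·ᵥ q) +ᵥ r) +ᵥ (c ·ᵥ w) ≡ (c ·ᵥ (q +ᵥ w)) +ᵥ r
  +ᵥ-·ᵥ-interchange c []      []      []      = refl
  +ᵥ-·ᵥ-interchange c (x ∷ q) (y ∷ r) (z ∷ w) = cong₂ _∷_ (ring c x y z) (+ᵥ-·ᵥ-interchange c q r w)
    where
    ring : ∀ c x y z → c * x + y + c * z ≡ c * (x + z) + y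
    ring = solve-∀

  +ᵥ-transpose : ∀ {n} (a b w : Vecℤ n) → a ≡ b +ᵥ w → a -ᵥ b ≡ w
  +ᵥ-transpose []      []      []      _ = refl
  +ᵥ-transpose (x ∷ a) (y ∷ b) (z ∷ w) e with VecP.∷-injective e
  ... | refl , a≡b+w = cong₂ _∷_ (ring y z) (+ᵥ-transpose a b w a≡b+w)
    where
    ring : ∀ y z → y + z - y ≡ z
    ring = solve-∀

  -ᵥ-transpose : ∀ {n} (a b w : Vecℤ n) → a -ᵥ b ≡ w → a ≡ b +ᵥ w
  -ᵥ-transpose []      []      []      _ = refl
  -ᵥ-transpose (x ∷ a) (y ∷ b) (z ∷ w) e with VecP.∷-injective e
  ... | refl , a-b≡w = cong₂ _∷_ (ring x y) (-ᵥ-transpose a b w a-b≡w)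
    where
    ring : ∀ x y → x ≡ y + (x - y)
    ring = solve-∀

  dot : ∀ {n} → Vecℤ n → Vecℤ n → ℤ
  dot r x = sumℤ (Vec.zipWith _*_ r x)

  dot-0ʳ : ∀ {n} (r : Vecℤ n) → dot r (0ᵥ n) ≡ 0ℤ
  dot-0ʳ []      = refl
  dot-0ʳ (a ∷ r) = cong₂ _+_ (ℤP.*-zeroʳ a) (dot-0ʳ r)

  dot-+ʳ : ∀ {n} (r x y : Vecℤ n) → dot r (x +ᵥ y) ≡ dot r x + dot r y
  dot-+ʳ []      []      []      = refl
  dot-+ʳ (a ∷ r) (b ∷ x) (c ∷ y) rewrite dot-+ʳ r x y = ring a b c (dot r x) (dot r y)
    where
    ring : ∀ a b c u v → a * (b + c) + (u + v) ≡ a * b + u + (a * c + v)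
    ring = solve-∀

  dot-·ʳ : ∀ {n} c (r x : Vecℤ n) → dot r (c ·ᵥ x) ≡ c * dot r x
  dot-·ʳ c []      []      = sym (ℤP.*-zeroʳ c)
  dot-·ʳ c (a ∷ r) (b ∷ x) rewrite dot-·ʳ c r x = ring a b c (dot r x)
    where
    ring : ∀ a b c u → a * (c * b) + c * u ≡ c * (a * b + u)
    ring = solve-∀

  dot-·ˡ : ∀ {n} c (r x : Vecℤ n) → dot (c ·ᵥ r) x ≡ c * dot r x
  dot-·ˡ c []      []      = sym (ℤP.*-zeroʳ c)
  dot-·ˡ c (a ∷ r) (b ∷ x) rewrite dot-·ˡ c r x = ring a b c (dot r x)
    where
    ring : ∀ a b c u → c * a * b + c * u ≡ c * (a * b + u)
    ring = solve-∀

  lookup-⊛ : ∀ {n} (M : Mat n) x i → lookup (M ⊛ x) i ≡ dot (lookup M i) x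
  lookup-⊛ M x i = VecP.lookup-map i _ M

  lookup-+ᵥ : ∀ {n} (u v : Vecℤ n) i → lookup (u +ᵥ v) i ≡ lookup u i + lookup v i
  lookup-+ᵥ u v i = VecP.lookup-zipWith _+_ i u v

  lookup-·ᵥ : ∀ {n} c (v : Vecℤ n) i → lookup (c ·ᵥ v) i ≡ c * lookup v i
  lookup-·ᵥ c v i = VecP.lookup-map i (c *_) v

  ⊛-0ᵥ : ∀ {n} (M : Mat n) → M ⊛ 0ᵥ n ≡ 0ᵥ n
  ⊛-0ᵥ {n} M = ≡-by-lookup λ i →
    trans (lookup-⊛ M (0ᵥ n) i) (trans (dot-0ʳ (lookup M i)) (sym (VecP.lookup-replicate i 0ℤ)))

  ⊛-+ᵥ : ∀ {n} (M : Mat n) x y → M ⊛ (x +ᵥ y) ≡ (M ⊛ x) +ᵥ (M ⊛ y)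
  ⊛-+ᵥ M x y = ≡-by-lookup λ i → begin
    lookup (M ⊛ (x +ᵥ y)) i                      ≡⟨ lookup-⊛ M (x +ᵥ y) i ⟩
    dot (lookup M i) (x +ᵥ y)                    ≡⟨ dot-+ʳ (lookup M i) x y ⟩
    dot (lookup M i) x + dot (lookup M i) y      ≡⟨ cong₂ _+_ (lookup-⊛ M x i) (lookup-⊛ M y i) ⟨
    lookup (M ⊛ x) i + lookup (M ⊛ y) i          ≡⟨ lookup-+ᵥ (M ⊛ x) (M ⊛ y) i ⟨
    lookup ((M ⊛ x) +ᵥ (M ⊛ y)) i                    ∎
    where open ≡-Reasoning

  ⊛-·ᵥ : ∀ {n} (M : Mat n) c x → M ⊛ (c ·ᵥ x) ≡ c ·ᵥ (M ⊛ x)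
  ⊛-·ᵥ M c x = ≡-by-lookup λ i → begin
    lookup (M ⊛ (c ·ᵥ x)) i     ≡⟨ lookup-⊛ M (c ·ᵥ x) i ⟩
    dot (lookup M i) (c ·ᵥ x)   ≡⟨ dot-·ʳ c (lookup M i) x ⟩
    c * dot (lookup M i) x      ≡⟨ cong (c *_) (lookup-⊛ M x i) ⟨
    c * lookup (M ⊛ x) i        ≡⟨ lookup-·ᵥ c (M ⊛ x) i ⟨
    lookup (c ·ᵥ (M ⊛ x)) i     ∎
    where open ≡-Reasoning

  ·ₘ-⊛ : ∀ {n} c (M : Mat n) x → (c ·ₘ M) ⊛ x ≡ c ·ᵥ (M ⊛ x)
  ·ₘ-⊛ c M x = ≡-by-lookup λ i → begin
    lookup ((c ·ₘ M) ⊛ x) i         ≡⟨ lookup-⊛ (c ·ₘ M) x i ⟩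
    dot (lookup (c ·ₘ M) i) x       ≡⟨ cong (λ r → dot r x) (VecP.lookup-map i (c ·ᵥ_) M) ⟩
    dot (c ·ᵥ lookup M i) x         ≡⟨ dot-·ˡ c (lookup M i) x ⟩
    c * dot (lookup M i) x          ≡⟨ cong (c *_) (lookup-⊛ M x i) ⟨
    c * lookup (M ⊛ x) i            ≡⟨ lookup-·ᵥ c (M ⊛ x) i ⟨
    lookup (c ·ᵥ (M ⊛ x)) i         ∎
    where open ≡-Reasoning

  ≡mod-refl : ∀ {n} (M : Mat n) a → a ≡ a [mod M ]
  ≡mod-refl {n} M a = 0ᵥ n , trans (-ᵥ-self a) (sym (⊛-0ᵥ M))

  ≡mod-sym : ∀ {n} (M : Mat n) {a b} → a ≡ b [mod M ] → b ≡ a [mod M ]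
  ≡mod-sym M {a} {b} (x , a-b≡Mx) =
    -1ℤ ·ᵥ x , trans (-ᵥ-anticomm a b) (trans (cong (-1ℤ ·ᵥ_) a-b≡Mx) (sym (⊛-·ᵥ M -1ℤ x)))

  ≡mod-trans : ∀ {n} (M : Mat n) {a b c} → a ≡ b [mod M ] → b ≡ c [mod M ] → a ≡ c [mod M ]
  ≡mod-trans M {a} {b} {c} (x , a-b≡Mx) (y , b-c≡My) =
    x +ᵥ y , trans (-ᵥ-telescope a b c) (trans (cong₂ _+ᵥ_ a-b≡Mx b-c≡My) (sym (⊛-+ᵥ M x y)))

  dot-tabulate : ∀ {k} (r : Vecℤ k) (f : Fin k → ℤ) → dot r (tabulate f) ≡ ∑[ l < k ] (lookup r l * f l)
  dot-tabulate []      f = refl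
  dot-tabulate (a ∷ r) f = cong (_+_ (a * f zero)) (dot-tabulate r (f ∘ suc))

  det≢0⇒multiples-in-image : ∀ n (M : Mat n) → det n M ≢ + 0 →
    ∃ λ B → ∀ y → ∃ λ x → M ⊛ x ≡ (+ suc B) ·ᵥ y
  det≢0⇒multiples-in-image n M det≢0
    with det′≢0⇒multiples-in-lattice n (entries M) (det≢0 ∘ trans (det≡det′ n M))
  ... | D , D≢0 , solve = positive D D≢0 inImage
    where
    inImage : ∀ y → ∃ λ x → M ⊛ x ≡ D ·ᵥ y
    inImage y = tabulate x , ≡-by-lookup λ i → begin
      lookup (M ⊛ tabulate x) i                       ≡⟨ lookup-⊛ M (tabulate x) i ⟩
      dot (lookup M i) (tabulate x)                   ≡⟨ dot-tabulate (lookup M i) x ⟩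
      ∑[ l < n ] (entries M i l * x l)                ≡⟨ proj₂ (solve (lookup y)) i ⟩
      D * lookup y i                                  ≡⟨ lookup-·ᵥ D y i ⟨
      lookup (D ·ᵥ y) i                               ∎
      where
      open ≡-Reasoning
      x = proj₁ (solve (lookup y))
    positive : ∀ D → D ≢ 0ℤ → (∀ y → ∃ λ x → M ⊛ x ≡ D ·ᵥ y) → ∃ λ B → ∀ y → ∃ λ x → M ⊛ x ≡ (+ suc B) ·ᵥ y
    positive (+ zero)   D≢0 _   = ⊥-elim (D≢0 refl)
    positive (+ suc B)  _   sol = B , sol
    -- -[1+ B ] * -1ℤ computes to + suc (B ℕ.* 1)
    positive -[1+ B ]   _   sol = B ℕ.* 1 , λ y → proj₁ (sol (-1ℤ ·ᵥ y)) ,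
      trans (proj₂ (sol (-1ℤ ·ᵥ y))) (·ᵥ-·ᵥ -[1+ B ] -1ℤ y)

  -- Euclidean division of integer vectors

  module Division (t′ : ℕ) where

    t : ℕ
    t = suc t′

    T : ℤ
    T = + t

    -- stated as in `scale`, so that `Box α` is literally the condition on α there
    Digit : ℤ → Set
    Digit a = (+ 0 ℤ.≤ a) × (a ℤ.≤ T - + 1)

    Box : ∀ {n} → Vecℤ n → Set
    Box = All Digit

    digit⇒<t : ∀ {a} → Digit a → ∃ λ m → a ≡ + m × m ℕ.< t
    digit⇒<t {+ m} (_ , ℤ.+≤+ m≤t′) = m , refl , s≤s m≤t′

    <t⇒digit : ∀ {m} → m ℕ.< t → Digit (+ m)
    <t⇒digit (s≤s m≤t′) = ℤ.+≤+ z≤n , ℤ.+≤+ m≤t′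

    quot : ∀ {n} → Vecℤ n → Vecℤ n
    quot = Vec.map (_/ℕ t)

    rem : ∀ {n} → Vecℤ n → Vecℤ n
    rem = Vec.map (λ z → + (z %ℕ t))

    div-mod : ∀ z → z ≡ T * (z /ℕ t) + + (z %ℕ t)
    div-mod z = trans (a≡a%ℕn+[a/ℕn]*n z t) (ring (+ (z %ℕ t)) (z /ℕ t) T)
      where
      ring : ∀ r q t → r + q * t ≡ t * q + r
      ring = solve-∀

    quotient-mono : ∀ {q q′ r r′} → + 0 ℤ.≤ r → Digit r′ → T * q + r ℤ.≤ T * q′ + r′ → q ℤ.≤ q′
    quotient-mono {q} {q′} {r′ = r′} (ℤ.+≤+ {n = b} _) (_ , r′≤t′) le = ℤP.≮⇒≥ λ q′<q → ℤP.<-irrefl refl (begin-strict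
      T * q′ + r′        <⟨ ℤP.+-monoʳ-< (T * q′) (ℤP.≤-<-trans r′≤t′ (ℤ.+<+ (ℕP.n<1+n t′))) ⟩
      T * q′ + T         ≡⟨ ring T q′ ⟩
      T * ℤ.suc q′       ≤⟨ ℤP.*-monoˡ-≤-nonNeg T (ℤP.i<j⇒suc[i]≤j q′<q) ⟩
      T * q              ≤⟨ ℤP.i≤i+j (T * q) (+ b) ⟩
      T * q + + b        ≤⟨ le ⟩
      T * q′ + r′        ∎)
      where
      open ℤP.≤-Reasoning
      ring : ∀ t q → t * q + t ≡ t * (1ℤ + q)
      ring = solve-∀

    quotient-unique : ∀ {q q′ r r′} → Digit r → Digit r′ → T * q + r ≡ T * q′ + r′ → q ≡ q′ × r ≡ r′
    quotient-unique {q} {q′} dr dr′ e = q≡q′ , ∙-cancelˡ (T * q) _ _ (trans e (cong (λ z → T * z + _) (sym q≡q′)))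
      where
      q≡q′ : q ≡ q′
      q≡q′ = ℤP.≤-antisym (quotient-mono (proj₁ dr) dr′ (ℤP.≤-reflexive e))
                          (quotient-mono (proj₁ dr′) dr (ℤP.≤-reflexive (sym e)))

    divMod : ∀ {n} (x : Vecℤ n) → x ≡ (T ·ᵥ quot x) +ᵥ rem x
    divMod []      = refl
    divMod (z ∷ x) = cong₂ _∷_ (div-mod z) (divMod x)

    rem-box : ∀ {n} (x : Vecℤ n) → Box (rem x)
    rem-box []      = []
    rem-box (z ∷ x) = <t⇒digit (n%ℕd<d z t) ∷ rem-box x

    0ᵥ-box : ∀ n → Box (0ᵥ n)
    0ᵥ-box zero    = []
    0ᵥ-box (suc n) = <t⇒digit (s≤s z≤n) ∷ 0ᵥ-box n

    divMod-mono : ∀ {n} (q q′ r r′ : Vecℤ n) → Nonneg r → Box r′ →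
      ((T ·ᵥ q) +ᵥ r) ≤ᵥ ((T ·ᵥ q′) +ᵥ r′) → q ≤ᵥ q′
    divMod-mono []      []        []      []        []           []            []         = []
    divMod-mono (_ ∷ q) (_ ∷ q′) (_ ∷ r) (_ ∷ r′) (0≤c ∷ r≥0) (dc′ ∷ r′-box) (le ∷ les) =
      quotient-mono 0≤c dc′ le ∷ divMod-mono q q′ r r′ r≥0 r′-box les

    divMod-unique : ∀ {n} (q q′ r r′ : Vecℤ n) → Box r → Box r′ →
      (T ·ᵥ q) +ᵥ r ≡ (T ·ᵥ q′) +ᵥ r′ → q ≡ q′ × r ≡ r′
    divMod-unique []      []       []      []       []         []           _ = refl , refl
    divMod-unique (a ∷ q) (a′ ∷ q′) (c ∷ r) (c′ ∷ r′) (dc ∷ r-box) (dc′ ∷ r′-box) e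
      with VecP.∷-injective e
    ... | e₀ , es with quotient-unique {a} {a′} dc dc′ e₀ | divMod-unique q q′ r r′ r-box r′-box es
    ...   | refl , refl | refl , refl = refl , refl

    quot-rem-unique : ∀ {n} (x q r : Vecℤ n) → Box r → x ≡ (T ·ᵥ q) +ᵥ r → quot x ≡ q × rem x ≡ r
    quot-rem-unique x q r r-box x≡ = divMod-unique (quot x) q (rem x) r (rem-box x) r-box (trans (sym (divMod x)) x≡)

    quot-rem-multiple : ∀ {n} (a : Vecℤ n) → quot (T ·ᵥ a) ≡ a × rem (T ·ᵥ a) ≡ 0ᵥ n
    quot-rem-multiple {n} a = quot-rem-unique (T ·ᵥ a) a (0ᵥ n) (0ᵥ-box n) (sym (+ᵥ-identityʳ (T ·ᵥ a)))

    box-nonneg : ∀ {n} {r : Vecℤ n} → Box r → Nonneg r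
    box-nonneg = All.map proj₁

    quot-nonneg : ∀ {n} (x : Vecℤ n) → Nonneg x → Nonneg (quot x)
    quot-nonneg x x≥0 = AllP.map⁺ (All.map (λ {z} → 0≤n⇒0≤n/ℕd z t) x≥0)

    affine-ℕ : ∀ m k → T * + m + + k ≡ + (t ℕ.* m ℕ.+ k)
    affine-ℕ m k = sym (trans (ℤP.pos-+ (t ℕ.* m) k) (cong (_+ + k) (ℤP.pos-* t m)))

    affine-nonneg : ∀ {n} (q r : Vecℤ n) → Nonneg q → Nonneg r → Nonneg ((T ·ᵥ q) +ᵥ r)
    affine-nonneg []      []      []                       []                       = []
    affine-nonneg (_ ∷ q) (_ ∷ r) (ℤ.+≤+ {n = m} _ ∷ q≥0) (ℤ.+≤+ {n = k} _ ∷ r≥0) =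
      subst (+ 0 ℤ.≤_) (sym (affine-ℕ m k)) (ℤ.+≤+ z≤n) ∷ affine-nonneg q r q≥0 r≥0

    norm-affine : ∀ {n} (q r : Vecℤ n) → Nonneg q → Nonneg r → ‖ (T ·ᵥ q) +ᵥ r ‖ ≡ t ℕ.* ‖ q ‖ ℕ.+ ‖ r ‖
    norm-affine []      []      []                       []                       = sym (trans (ℕP.+-identityʳ (t ℕ.* 0)) (ℕP.*-zeroʳ t))
    norm-affine (_ ∷ q) (_ ∷ r) (ℤ.+≤+ {n = m} _ ∷ q≥0) (ℤ.+≤+ {n = k} _ ∷ r≥0) =
      trans (cong₂ ℕ._+_ (cong ℤ.∣_∣ (affine-ℕ m k)) (norm-affine q r q≥0 r≥0)) (ring t m k ‖ q ‖ ‖ r ‖)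
      where
      ring : ∀ t m k u v → t ℕ.* m ℕ.+ k ℕ.+ (t ℕ.* u ℕ.+ v) ≡ t ℕ.* (m ℕ.+ u) ℕ.+ (k ℕ.+ v)
      ring = solveℕ-∀

    norm-divMod : ∀ {n} (x : Vecℤ n) → Nonneg x → ‖ x ‖ ≡ t ℕ.* ‖ quot x ‖ ℕ.+ ‖ rem x ‖
    norm-divMod x x≥0 = trans (cong ‖_‖ (divMod x))
      (norm-affine (quot x) (rem x) (quot-nonneg x x≥0) (box-nonneg (rem-box x)))

    box-norm : ∀ {n} {r : Vecℤ n} → Box r → ‖ r ‖ ℕ.≤ n ℕ.* t′
    box-norm []              = z≤n
    box-norm (dc ∷ r-box) with digit⇒<t dc
    ... | _ , refl , s≤s m≤t′ = ℕP.+-mono-≤ m≤t′ (box-norm r-box)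

    corner : ∀ n → Vecℤ n
    corner n = Vec.replicate n (+ t′)

    corner-box : ∀ n → Box (corner n)
    corner-box zero    = []
    corner-box (suc n) = <t⇒digit ℕP.≤-refl ∷ corner-box n

    corner-norm : ∀ n → ‖ corner n ‖ ≡ n ℕ.* t′
    corner-norm zero    = refl
    corner-norm (suc n) = cong (t′ ℕ.+_) (corner-norm n)

    ·ᵥ-mono : ∀ {n} {a b : Vecℤ n} → b ≤ᵥ a → (T ·ᵥ b) ≤ᵥ (T ·ᵥ a)
    ·ᵥ-mono []         = []
    ·ᵥ-mono (le ∷ les) = ℤP.*-monoˡ-≤-nonNeg T le ∷ ·ᵥ-mono les

    scale⇔ : ∀ {n} (L : CubeSet n) x → scale t L x ⇔ L (quot x)
    scale⇔ L x = mk⇔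
      (λ (a , La , α , α-box , x≡) → subst L (sym (proj₁ (quot-rem-unique x a α α-box x≡))) La)
      (λ Lq → quot x , Lq , rem x , rem-box x , divMod x)

    scale-multiple⇔ : ∀ {n} (L : CubeSet n) a → scale t L (T ·ᵥ a) ⇔ L a
    scale-multiple⇔ L a = subst (λ b → scale t L (T ·ᵥ a) ⇔ L b) (proj₁ (quot-rem-multiple a)) (scale⇔ L (T ·ᵥ a))

    ≡mod-scaled⇔ : ∀ {n} (M : Mat n) x y → x ≡ y [mod T ·ₘ M ] ⇔ ((rem x ≡ rem y) × (quot x ≡ quot y [mod M ]))
    ≡mod-scaled⇔ M x y = mk⇔ to from
      where
      open ≡-Reasoning
      to : x ≡ y [mod T ·ₘ M ] → (rem x ≡ rem y) × (quot x ≡ quot y [mod M ])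
      to (z , x-y≡) = proj₂ unique , z , +ᵥ-transpose (quot x) (quot y) (M ⊛ z) (proj₁ unique)
        where
        x≡ : x ≡ (T ·ᵥ (quot y +ᵥ (M ⊛ z))) +ᵥ rem y
        x≡ = begin
          x                                          ≡⟨ -ᵥ-transpose x y _ x-y≡ ⟩
          y +ᵥ ((T ·ₘ M) ⊛ z)                        ≡⟨ cong₂ _+ᵥ_ (divMod y) (·ₘ-⊛ T M z) ⟩
          ((T ·ᵥ quot y) +ᵥ rem y) +ᵥ (T ·ᵥ (M ⊛ z))  ≡⟨ +ᵥ-·ᵥ-interchange T (quot y) (rem y) (M ⊛ z) ⟩
          (T ·ᵥ (quot y +ᵥ (M ⊛ z))) +ᵥ rem y        ∎
        unique = quot-rem-unique x (quot y +ᵥ (M ⊛ z)) (rem y) (rem-box y) x≡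
      from : (rem x ≡ rem y) × (quot x ≡ quot y [mod M ]) → x ≡ y [mod T ·ₘ M ]
      from (rx≡ry , z , qx-qy≡) = z , (begin
        x -ᵥ y                                                  ≡⟨ cong₂ _-ᵥ_ (divMod x) (divMod y) ⟩
        ((T ·ᵥ quot x) +ᵥ rem x) -ᵥ ((T ·ᵥ quot y) +ᵥ rem y)    ≡⟨ cong (λ r → ((T ·ᵥ quot x) +ᵥ r) -ᵥ _) rx≡ry ⟩
        ((T ·ᵥ quot x) +ᵥ rem y) -ᵥ ((T ·ᵥ quot y) +ᵥ rem y)    ≡⟨ -ᵥ-affine T (quot x) (quot y) (rem y) ⟩
        T ·ᵥ (quot x -ᵥ quot y)                                 ≡⟨ cong (T ·ᵥ_) qx-qy≡ ⟩
        T ·ᵥ (M ⊛ z)                                            ≡⟨ ·ₘ-⊛ T M z ⟨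
        (T ·ₘ M) ⊛ z                                            ∎)

    boxList : ∀ n → List (Vecℤ n)
    boxList zero    = [] List.∷ List.[]
    boxList (suc n) = cartesianProductWith _∷_ (List.map +_ (upTo t)) (boxList n)

    ∈-boxList⁺ : ∀ {n} {α : Vecℤ n} → Box α → α ∈ boxList n
    ∈-boxList⁺ []             = here refl
    ∈-boxList⁺ (dc ∷ α-box) with digit⇒<t dc
    ... | _ , refl , m<t = ∈-cartesianProductWith⁺ _∷_ (∈-map⁺ +_ (∈-upTo⁺ m<t)) (∈-boxList⁺ α-box)

    ∈-boxList⁻ : ∀ n {α : Vecℤ n} → α ∈ boxList n → Box α
    ∈-boxList⁻ zero    {[]}    _ = []
    ∈-boxList⁻ (suc n) {c ∷ α} α∈ with ∈-cartesianProductWith⁻ _∷_ (List.map +_ (upTo t)) (boxList n) α∈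
    ... | _ , _ , c∈ , α∈′ , e with VecP.∷-injective e
    ...   | refl , refl with ∈-map⁻ +_ c∈
    ...     | _ , m∈ , refl = <t⇒digit (∈-upTo⁻ m∈) ∷ ∈-boxList⁻ n α∈′

  -- Transversals

  injective⇒hits : ∀ {m n} (f : Fin m → Fin n) → m ≡ n → (∀ {p q} → f p ≡ f q → p ≡ q) → ∀ e → ¬ (∀ p → f p ≢ e)
  injective⇒hits {suc m} f refl f-injective e misses
    with FinP.pigeonhole (ℕP.n<1+n m) (λ p → punchOut (misses p ∘ sym))
  ... | p , q , p<q , same =
    ℕP.<-irrefl (cong toℕ (f-injective (FinP.punchOut-injective {i = e} (misses p ∘ sym) (misses q ∘ sym) same))) p<q

  allPairs-lookup : ∀ {A : Set} {R : A → A → Set} {xs : List A} → AllPairs R xs →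
    ∀ {i j} → i ≢ j → R (List.lookup xs i) (List.lookup xs j) ⊎ R (List.lookup xs j) (List.lookup xs i)
  allPairs-lookup (_  ∷ _)   {zero}  {zero}  i≢j = ⊥-elim (i≢j refl)
  allPairs-lookup (Rx ∷ _)   {zero}  {suc j} _   = inj₁ (ListAll.lookup Rx (∈-lookup j))
  allPairs-lookup (Rx ∷ _)   {suc i} {zero}  _   = inj₂ (ListAll.lookup Rx (∈-lookup i))
  allPairs-lookup (_  ∷ Rxs) {suc i} {suc j} i≢j = allPairs-lookup Rxs (i≢j ∘ cong suc)

  module Transversals {A : Set} (_~_ : A → A → Set) (~-equivalence : IsEquivalence _~_) where

    open IsEquivalence ~-equivalence using (reflexive) renaming (sym to ~-sym; trans to ~-trans)

    Covering : List A → Set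
    Covering xs = ∀ a → ∃ λ x → x ∈ xs × a ~ x

    Incongruent : List A → Set
    Incongruent xs = ∀ {x y} → x ∈ xs → y ∈ xs → x ~ y → x ≡ y

    Transversal : List A → Set
    Transversal xs = Covering xs × AllPairs (λ r s → ¬ r ~ s) xs

    ≡-from-index : ∀ {xs} {x y : A} (x∈ : x ∈ xs) (y∈ : y ∈ xs) → index x∈ ≡ index y∈ → x ≡ y
    ≡-from-index {xs} x∈ y∈ i≡j = trans (lookup-index x∈) (trans (cong (List.lookup xs) i≡j) (sym (lookup-index y∈)))

    allPairs⇒lookup-injective : ∀ {xs} → AllPairs (λ r s → ¬ r ~ s) xs →
      ∀ {p q} → List.lookup xs p ~ List.lookup xs q → p ≡ q
    allPairs⇒lookup-injective distinct {p} {q} xp~xq with p FinP.≟ q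
    ... | yes p≡q = p≡q
    ... | no  p≢q = ⊥-elim ([ (λ xp≁xq → xp≁xq xp~xq) , (λ xq≁xp → xq≁xp (~-sym xp~xq)) ]′ (allPairs-lookup distinct p≢q))

    allPairs⇒incongruent : ∀ {xs} → AllPairs (λ r s → ¬ r ~ s) xs → Incongruent xs
    allPairs⇒incongruent distinct x∈ y∈ x~y = ≡-from-index x∈ y∈
      (allPairs⇒lookup-injective distinct (subst₂ _~_ (lookup-index x∈) (lookup-index y∈) x~y))

    allPairs⇒unique : ∀ {xs} → AllPairs (λ r s → ¬ r ~ s) xs → Unique xs
    allPairs⇒unique = AllPairs.map (λ r≁s r≡s → r≁s (reflexive r≡s))

    unique∧incongruent⇒allPairs : ∀ {xs} → Unique xs → Incongruent xs → AllPairs (λ r s → ¬ r ~ s) xs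
    unique∧incongruent⇒allPairs []                        _            = []
    unique∧incongruent⇒allPairs (x≢xs ∷ xs-unique) incongruent =
      ListAll.tabulate (λ y∈ x~y → ListAll.lookup x≢xs y∈ (incongruent (here refl) (there y∈) x~y))
      ∷ unique∧incongruent⇒allPairs xs-unique (λ x∈ y∈ → incongruent (there x∈) (there y∈))

    -- pigeonhole: choosing a representative in ls for each element of rs is injective, and would miss
    -- one of the positions of x and y if these were distinct
    equinumerous⇒incongruent : ∀ {ls rs} → Transversal rs → length ls ≡ length rs → Covering ls → Incongruent ls
    equinumerous⇒incongruent {ls} {rs} (rs-covering , rs-distinct) same-length ls-covering {x} {y} x∈ y∈ x~y
      with index x∈ FinP.≟ index y∈
    ... | yes i≡j = ≡-from-index x∈ y∈ i≡j
    ... | no  i≢j = ⊥-elim (injective⇒hits pick (sym same-length) pick-injective (proj₁ missed) (proj₂ missed))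
      where
      i = index x∈
      j = index y∈
      class : Fin (length ls) → Fin (length rs)
      class k = index (proj₁ (proj₂ (rs-covering (List.lookup ls k))))
      ls~class : ∀ k → List.lookup ls k ~ List.lookup rs (class k)
      ls~class k with rs-covering (List.lookup ls k)
      ... | _ , r∈ , a~r = subst (List.lookup ls k ~_) (lookup-index r∈) a~r
      pick : Fin (length rs) → Fin (length ls)
      pick p = index (proj₁ (proj₂ (ls-covering (List.lookup rs p))))
      rs~pick : ∀ p → List.lookup rs p ~ List.lookup ls (pick p)
      rs~pick p with ls-covering (List.lookup rs p)
      ... | _ , l∈ , r~l = subst (List.lookup rs p ~_) (lookup-index l∈) r~l
      rs-injective : ∀ {p q} → List.lookup rs p ~ List.lookup rs q → p ≡ q
      rs-injective = allPairs⇒lookup-injective rs-distinct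
      class∘pick : ∀ p → class (pick p) ≡ p
      class∘pick p = rs-injective (~-trans (~-sym (ls~class (pick p))) (~-sym (rs~pick p)))
      pick-injective : ∀ {p q} → pick p ≡ pick q → p ≡ q
      pick-injective {p} {q} e = trans (sym (class∘pick p)) (trans (cong class e) (class∘pick q))
      class-i≡class-j : class i ≡ class j
      class-i≡class-j = rs-injective (~-trans (~-sym (ls~class i))
        (~-trans (subst₂ _~_ (lookup-index x∈) (lookup-index y∈) x~y) (ls~class j)))
      hits⇒class : ∀ {p k} → pick p ≡ k → p ≡ class k
      hits⇒class {p} e = trans (sym (class∘pick p)) (cong class e)
      missed : ∃ λ e → ∀ p → pick p ≢ e
      missed with pick (class i) FinP.≟ i
      ... | yes hits-i = j , λ p p↦j →
            i≢j (trans (sym hits-i) (trans (cong pick (sym (trans (hits⇒class p↦j) (sym class-i≡class-j)))) p↦j))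
      ... | no  miss-i = i , λ p p↦i → miss-i (trans (cong pick (sym (hits⇒class p↦i))) p↦i)

    deduplicate-transversal : (_≟_ : DecidableEquality A) → ∀ {xs} → Covering xs → Incongruent xs →
      Transversal (List.deduplicate _≟_ xs)
    deduplicate-transversal _≟_ {xs} covering incongruent =
      (λ a → let x , x∈ , a~x = covering a in x , ∈-deduplicate⁺ _≟_ x∈ , a~x) ,
      unique∧incongruent⇒allPairs (deduplicate-! xs)
        (λ x∈ y∈ → incongruent (∈-deduplicate⁻ _≟_ xs x∈) (∈-deduplicate⁻ _≟_ xs y∈))
      where open import Data.List.Relation.Unary.Unique.DecPropositional.Properties _≟_ using (deduplicate-!)

  ≡mod-isEquivalence : ∀ {n} (M : Mat n) → IsEquivalence (λ a b → a ≡ b [mod M ])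
  ≡mod-isEquivalence M = record { refl = ≡mod-refl M _ ; sym = ≡mod-sym M ; trans = ≡mod-trans M }

  module Residues {n} (M : Mat n) = Transversals (λ a b → a ≡ b [mod M ]) (≡mod-isEquivalence M)

  _≟ᵥ_ : ∀ {n} → DecidableEquality (Vecℤ n)
  _≟ᵥ_ = VecP.≡-dec ℤP._≟_

  InOrthant : ∀ {n} → CubeSet n → Set
  InOrthant L = ∀ a → L a → Nonneg a

  DownClosed : ∀ {n} → CubeSet n → Set
  DownClosed L = ∀ a b → L a → Nonneg b → b ≤ᵥ a → L b

  TransversalSet : ∀ {n} → Mat n → CubeSet n → Set
  TransversalSet M L = ∃ λ ls → (∀ a → L a ⇔ a ∈ ls) × ResidueSystem M ls

  transversalSet-incongruent : ∀ {n} (M : Mat n) {L} → TransversalSet M L →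
    ∀ {a b} → L a → L b → a ≡ b [mod M ] → a ≡ b
  transversalSet-incongruent M (ls , L⇔ , _ , distinct) La Lb =
    Residues.allPairs⇒incongruent M distinct (Equivalence.to (L⇔ _) La) (Equivalence.to (L⇔ _) Lb)

  -- the N cubes of a hyper-L cover the N classes, hence represent each exactly once
  hyperL⇔ : ∀ {n} (M : Mat n) L → HyperL M L ⇔ (InOrthant L × TransversalSet M L × DownClosed L)
  hyperL⇔ M L = mk⇔
    (λ (orthant , (ls , rs , L⇔ , ls-unique , rs-system , same-length) , covers , downClosed) →
      let ls-covering : Covering ls
          ls-covering g = let a , La , a≡g = covers g in a , Equivalence.to (L⇔ a) La , ≡mod-sym M a≡g
      in orthant ,
         (ls , L⇔ , ls-covering ,
          unique∧incongruent⇒allPairs ls-unique (equinumerous⇒incongruent rs-system same-length ls-covering)) ,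
         downClosed)
    (λ (orthant , (ls , L⇔ , ls-system) , downClosed) →
      orthant ,
      (ls , ls , L⇔ , allPairs⇒unique (proj₂ ls-system) , ls-system , refl) ,
      (λ g → let a , a∈ , g≡a = proj₁ ls-system g in a , Equivalence.from (L⇔ a) a∈ , ≡mod-sym M g≡a) ,
      downClosed)
    where open Residues M

  -- Walks

  -ᵥ-identityʳ : ∀ {n} (v : Vecℤ n) → v -ᵥ 0ᵥ n ≡ v
  -ᵥ-identityʳ = VecP.zipWith-identityʳ ℤP.+-identityʳ

  +ᵥ-sub-shift : ∀ {n} (u s v : Vecℤ n) → (u +ᵥ s) -ᵥ v ≡ s -ᵥ (v -ᵥ u)
  +ᵥ-sub-shift []      []      []      = refl
  +ᵥ-sub-shift (x ∷ u) (y ∷ s) (z ∷ v) = cong₂ _∷_ (ring x y z) (+ᵥ-sub-shift u s v)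
    where
    ring : ∀ x y z → x + y - z ≡ y - (z - x)
    ring = solve-∀

  steps : ∀ {n} → List (Fin n) → Vecℤ n
  steps {n} w = walkEnd (0ᵥ n) w

  step-+ᵥ : ∀ {n} (u c : Vecℤ n) i → step (u +ᵥ c) i ≡ u +ᵥ step c i
  step-+ᵥ (x ∷ u) (y ∷ c) zero    = cong (_∷ _) (ℤP.+-assoc x y 1ℤ)
  step-+ᵥ (x ∷ u) (y ∷ c) (suc i) = cong (_ ∷_) (step-+ᵥ u c i)

  walkEnd-+ᵥ : ∀ {n} (u c : Vecℤ n) w → walkEnd (u +ᵥ c) w ≡ u +ᵥ walkEnd c w
  walkEnd-+ᵥ u c List.[]        = refl
  walkEnd-+ᵥ u c (i List.∷ w) = trans (cong (λ v → walkEnd v w) (step-+ᵥ u c i)) (walkEnd-+ᵥ u (step c i) w)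

  walkEnd≡+steps : ∀ {n} (u : Vecℤ n) w → walkEnd u w ≡ u +ᵥ steps w
  walkEnd≡+steps {n} u w = trans (cong (λ v → walkEnd v w) (sym (+ᵥ-identityʳ u))) (walkEnd-+ᵥ u (0ᵥ n) w)

  walk⇔ : ∀ {n} (M : Mat n) u w v → Walk M u w v ⇔ steps w ≡ v -ᵥ u [mod M ]
  walk⇔ M u w v = mk⇔
    (λ (x , e) → x , trans (sym (+ᵥ-sub-shift u (steps w) v)) (trans (cong (_-ᵥ v) (sym (walkEnd≡+steps u w))) e))
    (λ (x , e) → x , trans (cong (_-ᵥ v) (walkEnd≡+steps u w)) (trans (+ᵥ-sub-shift u (steps w) v) e))

  step-nonneg : ∀ {n} (c : Vecℤ n) i → Nonneg c → Nonneg (step c i)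
  step-nonneg (_ ∷ c) zero    (ℤ.+≤+ _ ∷ c≥0) = ℤ.+≤+ z≤n ∷ c≥0
  step-nonneg (_ ∷ c) (suc i) (cᵢ≥0 ∷ c≥0)   = cᵢ≥0 ∷ step-nonneg c i c≥0

  norm-step : ∀ {n} (c : Vecℤ n) i → Nonneg c → ‖ step c i ‖ ≡ suc ‖ c ‖
  norm-step (_ ∷ c) zero    (ℤ.+≤+ {n = a} _ ∷ _)   = cong (ℕ._+ ‖ c ‖) (ℕP.+-comm a 1)
  norm-step (_ ∷ c) (suc i) (ℤ.+≤+ {n = a} _ ∷ c≥0) = trans (cong (a ℕ.+_) (norm-step c i c≥0)) (ℕP.+-suc a ‖ c ‖)

  walkEnd-nonneg-norm : ∀ {n} (c : Vecℤ n) w → Nonneg c → Nonneg (walkEnd c w) × ‖ walkEnd c w ‖ ≡ ‖ c ‖ ℕ.+ length w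
  walkEnd-nonneg-norm c List.[]        c≥0 = c≥0 , sym (ℕP.+-identityʳ _)
  walkEnd-nonneg-norm c (i List.∷ w) c≥0 with walkEnd-nonneg-norm (step c i) w (step-nonneg c i c≥0)
  ... | end≥0 , end-norm = end≥0 , trans end-norm (trans (cong (ℕ._+ length w) (norm-step c i c≥0)) (sym (ℕP.+-suc _ _)))

  steps-nonneg-norm : ∀ {n} (w : List (Fin n)) → Nonneg (steps w) × ‖ steps w ‖ ≡ length w
  steps-nonneg-norm {n} w with walkEnd-nonneg-norm (0ᵥ n) w (0ᵥ-nonneg n)
  ... | steps≥0 , steps-norm = steps≥0 , trans steps-norm (cong (ℕ._+ length w) (norm-0ᵥ n))

  walkEnd-++ : ∀ {n} (c : Vecℤ n) w₁ w₂ → walkEnd c (w₁ List.++ w₂) ≡ walkEnd (walkEnd c w₁) w₂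
  walkEnd-++ c List.[]         w₂ = refl
  walkEnd-++ c (i List.∷ w₁) w₂ = walkEnd-++ (step c i) w₁ w₂

  walkEnd-replicate : ∀ {n} c (cs : Vecℤ n) a → walkEnd (c ∷ cs) (List.replicate a zero) ≡ (c + + a) ∷ cs
  walkEnd-replicate c cs zero    = cong (_∷ cs) (sym (ℤP.+-identityʳ c))
  walkEnd-replicate c cs (suc a) = trans (walkEnd-replicate (c + 1ℤ) cs a) (cong (_∷ cs) (ℤP.+-assoc c 1ℤ (+ a)))

  walkEnd-map-suc : ∀ {n} c (cs : Vecℤ n) w → walkEnd (c ∷ cs) (List.map suc w) ≡ c ∷ walkEnd cs w
  walkEnd-map-suc c cs List.[]        = refl
  walkEnd-map-suc c cs (i List.∷ w) = walkEnd-map-suc c (step cs i) w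

  walk-of : ∀ {n} (x : Vecℤ n) → Nonneg x → ∃ λ w → steps w ≡ x × length w ≡ ‖ x ‖
  walk-of []      []                         = List.[] , refl , refl
  walk-of {suc n} (_ ∷ x) (ℤ.+≤+ {n = a} _ ∷ x≥0) with walk-of x x≥0
  ... | w , steps-w , length-w =
    List.replicate a zero List.++ List.map suc w ,
    trans (walkEnd-++ (0ᵥ (suc n)) (List.replicate a zero) (List.map suc w))
      (trans (cong (λ c → walkEnd c (List.map suc w)) (walkEnd-replicate 0ℤ (0ᵥ n) a))
        (trans (walkEnd-map-suc (+ a) (0ᵥ n) w) (cong (+ a ∷_) steps-w))) ,
    trans (ListP.length-++ (List.replicate a zero))
      (cong₂ ℕ._+_ (ListP.length-replicate a) (trans (ListP.length-map suc w) length-w))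

  Covers : ∀ {n} → Mat n → ℕ → Set
  Covers {n} M d = ∀ (g : Vecℤ n) → ∃ λ x → Nonneg x × x ≡ g [mod M ] × ‖ x ‖ ℕ.≤ d

  Far : ∀ {n} → Mat n → ℕ → Set
  Far {n} M d = ∃ λ (g : Vecℤ n) → ∀ x → Nonneg x → x ≡ g [mod M ] → d ℕ.≤ ‖ x ‖

  walk-from-0⇒≡mod : ∀ {n} (M : Mat n) w g → Walk M (0ᵥ n) w g → steps w ≡ g [mod M ]
  walk-from-0⇒≡mod {n} M w g walk =
    subst (λ h → steps w ≡ h [mod M ]) (-ᵥ-identityʳ g) (Equivalence.to (walk⇔ M (0ᵥ n) w g) walk)

  walk-realising : ∀ {n} (M : Mat n) u v x → Nonneg x → x ≡ v -ᵥ u [mod M ] →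
    ∃ λ w → Walk M u w v × length w ≡ ‖ x ‖
  walk-realising M u v x x≥0 x≡ with walk-of x x≥0
  ... | w , steps-w , length-w =
    w , Equivalence.from (walk⇔ M u w v) (subst (λ s → s ≡ v -ᵥ u [mod M ]) (sym steps-w) x≡) , length-w

  -- by translation invariance, distances from 0 suffice
  digraphDiameter⇔ : ∀ {n} (M : Mat n) d → IsDigraphDiameter M d ⇔ (Covers M d × Far M d)
  digraphDiameter⇔ {n} M d = mk⇔
    (λ (upper , u , v , lower) →
      (λ g → let w , walk , short = upper (0ᵥ n) g
                 steps≥0 , steps-norm = steps-nonneg-norm w
             in steps w , steps≥0 , walk-from-0⇒≡mod M w g walk , subst (ℕ._≤ d) (sym steps-norm) short) ,
      v -ᵥ u ,
      (λ x x≥0 x≡ → let w , walk , length-w = walk-realising M u v x x≥0 x≡ in subst (d ℕ.≤_) length-w (lower w walk)))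
    (λ (covers , g , far) →
      (λ u v → let x , x≥0 , x≡ , short = covers (v -ᵥ u)
                   w , walk , length-w = walk-realising M u v x x≥0 x≡
               in w , walk , subst (ℕ._≤ d) (sym length-w) short) ,
      0ᵥ n , g ,
      (λ w walk → let steps≥0 , steps-norm = steps-nonneg-norm w in
        subst (d ℕ.≤_) steps-norm (far (steps w) steps≥0 (walk-from-0⇒≡mod M w g walk))))

  -- Scaling

  [1+t′][d+n]∸n≡[1+t′]d+nt′ : ∀ t′ d n → suc t′ ℕ.* (d ℕ.+ n) ℕ.∸ n ≡ suc t′ ℕ.* d ℕ.+ n ℕ.* t′
  [1+t′][d+n]∸n≡[1+t′]d+nt′ t′ d n = trans (cong (ℕ._∸ n) (ring t′ d n)) (ℕP.m+n∸n≡m _ n)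
    where
    ring : ∀ t′ d n → suc t′ ℕ.* (d ℕ.+ n) ≡ suc t′ ℕ.* d ℕ.+ n ℕ.* t′ ℕ.+ n
    ring = solveℕ-∀

  module Scaling (t′ : ℕ) {n : ℕ} (M : Mat n) where

    open Division t′
    open Equivalence using (to; from)

    tM : Mat n
    tM = T ·ₘ M

    multiple-nonneg : ∀ {b : Vecℤ n} → Nonneg b → Nonneg (T ·ᵥ b)
    multiple-nonneg {b} b≥0 = subst Nonneg (+ᵥ-identityʳ (T ·ᵥ b)) (affine-nonneg b (0ᵥ n) b≥0 (0ᵥ-nonneg n))

    norm-multiple : ∀ {a : Vecℤ n} → Nonneg a → ‖ T ·ᵥ a ‖ ≡ t ℕ.* ‖ a ‖
    norm-multiple {a} a≥0 = begin
      ‖ T ·ᵥ a ‖                     ≡⟨ cong ‖_‖ (+ᵥ-identityʳ (T ·ᵥ a)) ⟨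
      ‖ (T ·ᵥ a) +ᵥ 0ᵥ n ‖           ≡⟨ norm-affine a (0ᵥ n) a≥0 (0ᵥ-nonneg n) ⟩
      t ℕ.* ‖ a ‖ ℕ.+ ‖ 0ᵥ n ‖       ≡⟨ cong (t ℕ.* ‖ a ‖ ℕ.+_) (norm-0ᵥ n) ⟩
      t ℕ.* ‖ a ‖ ℕ.+ 0              ≡⟨ ℕP.+-identityʳ _ ⟩
      t ℕ.* ‖ a ‖                    ∎
      where open ≡-Reasoning

    ·ᵥ-injective : ∀ {a b : Vecℤ n} → T ·ᵥ a ≡ T ·ᵥ b → a ≡ b
    ·ᵥ-injective {a} {b} e = trans (sym (proj₁ (quot-rem-multiple a))) (trans (cong quot e) (proj₁ (quot-rem-multiple b)))

    ·ᵥ-≡mod : ∀ {a b} → a ≡ b [mod M ] → (T ·ᵥ a) ≡ (T ·ᵥ b) [mod tM ]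
    ·ᵥ-≡mod {a} {b} a≡b = from (≡mod-scaled⇔ M (T ·ᵥ a) (T ·ᵥ b))
      ( trans (proj₂ (quot-rem-multiple a)) (sym (proj₂ (quot-rem-multiple b)))
      , subst₂ (λ u v → u ≡ v [mod M ]) (sym (proj₁ (quot-rem-multiple a))) (sym (proj₁ (quot-rem-multiple b))) a≡b )

    inOrthant-scale⇔ : ∀ (L : CubeSet n) → InOrthant L ⇔ InOrthant (scale t L)
    inOrthant-scale⇔ L = mk⇔
      (λ orthant x x∈ → subst Nonneg (sym (divMod x))
        (affine-nonneg (quot x) (rem x) (orthant _ (to (scale⇔ L x) x∈)) (box-nonneg (rem-box x))))
      (λ orthant a La → subst Nonneg (proj₁ (quot-rem-multiple a))
        (quot-nonneg (T ·ᵥ a) (orthant _ (from (scale-multiple⇔ L a) La))))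

    downClosed-scale⇔ : ∀ (L : CubeSet n) → DownClosed L ⇔ DownClosed (scale t L)
    downClosed-scale⇔ L = mk⇔
      (λ downClosed x y x∈ y≥0 y≤x → from (scale⇔ L y)
        (downClosed (quot x) (quot y) (to (scale⇔ L x) x∈) (quot-nonneg y y≥0)
          (divMod-mono (quot y) (quot x) (rem y) (rem x) (box-nonneg (rem-box y)) (rem-box x)
            (subst₂ _≤ᵥ_ (divMod y) (divMod x) y≤x))))
      (λ downClosed a b La b≥0 b≤a → to (scale-multiple⇔ L b)
        (downClosed (T ·ᵥ a) (T ·ᵥ b) (from (scale-multiple⇔ L a) La) (multiple-nonneg b≥0) (·ᵥ-mono b≤a)))

    transversalSet-scale : ∀ (L : CubeSet n) → TransversalSet M L → TransversalSet tM (scale t L)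
    transversalSet-scale L (ls , L⇔ , ls-covering , ls-distinct) =
      List.deduplicate _≟ᵥ_ candidates ,
      (λ x → ⇔.trans (∈candidates⇔ x) (deduplicate-∈⇔ _≟ᵥ_)) ,
      deduplicate-transversal _≟ᵥ_ covering incongruent
      where
      open Residues tM
      candidates = cartesianProductWith (λ a α → (T ·ᵥ a) +ᵥ α) ls (boxList n)
      ∈candidates⇔ : ∀ x → scale t L x ⇔ x ∈ candidates
      ∈candidates⇔ x = mk⇔
        (λ (a , La , α , α-box , x≡) → subst (_∈ candidates) (sym x≡)
          (∈-cartesianProductWith⁺ (λ a α → (T ·ᵥ a) +ᵥ α) (to (L⇔ a) La) (∈-boxList⁺ α-box)))
        (λ x∈ → let a , α , a∈ , α∈ , x≡ = ∈-cartesianProductWith⁻ (λ a α → (T ·ᵥ a) +ᵥ α) ls (boxList n) x∈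
                in a , from (L⇔ a) a∈ , α , ∈-boxList⁻ n α∈ , x≡)
      covering : Covering candidates
      covering g with ls-covering (quot g)
      ... | a , a∈ , qg≡a = x , to (∈candidates⇔ x) (a , from (L⇔ a) a∈ , rem g , rem-box g , refl) ,
        from (≡mod-scaled⇔ M g x) (sym (proj₂ x-digits) , subst (λ q → quot g ≡ q [mod M ]) (sym (proj₁ x-digits)) qg≡a)
        where
        x = (T ·ᵥ a) +ᵥ rem g
        x-digits = quot-rem-unique x a (rem g) (rem-box g) refl
      incongruent : Incongruent candidates
      incongruent {x} {y} x∈ y∈ x≡y = begin
        x                                ≡⟨ divMod x ⟩
        (T ·ᵥ quot x) +ᵥ rem x           ≡⟨ cong₂ (λ q r → (T ·ᵥ q) +ᵥ r) quot-x≡quot-y rem-x≡rem-y ⟩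
        (T ·ᵥ quot y) +ᵥ rem y           ≡⟨ divMod y ⟨
        y                                ∎
        where
        open ≡-Reasoning
        rem-x≡rem-y = proj₁ (to (≡mod-scaled⇔ M x y) x≡y)
        quot-x≡quot-y = transversalSet-incongruent M (ls , L⇔ , ls-covering , ls-distinct)
          (to (scale⇔ L x) (from (∈candidates⇔ x) x∈)) (to (scale⇔ L y) (from (∈candidates⇔ y) y∈))
          (proj₂ (to (≡mod-scaled⇔ M x y) x≡y))

    transversalSet-unscale : ∀ (L : CubeSet n) → TransversalSet tM (scale t L) → TransversalSet M L
    transversalSet-unscale L (lsᵗ , tL⇔ , lsᵗ-covering , lsᵗ-distinct) =
      List.deduplicate _≟ᵥ_ candidates ,
      (λ a → ⇔.trans (∈candidates⇔ a) (deduplicate-∈⇔ _≟ᵥ_)) ,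
      deduplicate-transversal _≟ᵥ_ covering incongruent
      where
      open Residues M
      candidates = List.map quot lsᵗ
      ∈candidates⇔ : ∀ a → L a ⇔ a ∈ candidates
      ∈candidates⇔ a = mk⇔
        (λ La → subst (_∈ candidates) (proj₁ (quot-rem-multiple a))
          (∈-map⁺ quot (to (tL⇔ (T ·ᵥ a)) (from (scale-multiple⇔ L a) La))))
        (λ a∈ → let x , x∈ , a≡ = ∈-map⁻ quot a∈ in subst L (sym a≡) (to (scale⇔ L x) (from (tL⇔ x) x∈)))
      covering : Covering candidates
      covering g = let x , x∈ , Tg≡x = lsᵗ-covering (T ·ᵥ g) in
        quot x , ∈-map⁺ quot x∈ ,
        subst (λ q → q ≡ quot x [mod M ]) (proj₁ (quot-rem-multiple g)) (proj₂ (to (≡mod-scaled⇔ M (T ·ᵥ g) x) Tg≡x))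
      incongruent : Incongruent candidates
      incongruent {a} {b} a∈ b∈ a≡b = ·ᵥ-injective
        (transversalSet-incongruent tM (lsᵗ , tL⇔ , lsᵗ-covering , lsᵗ-distinct)
          (from (scale-multiple⇔ L a) (from (∈candidates⇔ a) a∈)) (from (scale-multiple⇔ L b) (from (∈candidates⇔ b) b∈))
          (·ᵥ-≡mod a≡b))

    transversalSet-scale⇔ : ∀ (L : CubeSet n) → TransversalSet M L ⇔ TransversalSet tM (scale t L)
    transversalSet-scale⇔ L = mk⇔ (transversalSet-scale L) (transversalSet-unscale L)

    hyperL-scale⇔ : ∀ (L : CubeSet n) → HyperL M L ⇔ HyperL tM (scale t L)
    hyperL-scale⇔ L = ⇔.trans (hyperL⇔ M L) (⇔.trans
      (inOrthant-scale⇔ L ×-⇔ transversalSet-scale⇔ L ×-⇔ downClosed-scale⇔ L)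
      (⇔.sym (hyperL⇔ tM (scale t L))))

    diameter-scale : ∀ (L : CubeSet n) → HyperL M L →
      ∃ λ d → IsDiameter L d × IsDiameter (scale t L) (t ℕ.* (d ℕ.+ n) ℕ.∸ n)
    diameter-scale L hyperL with to (hyperL⇔ M L) hyperL
    ... | orthant , (ls , L⇔ , ls-covering , _) , _ with ls-covering (0ᵥ n)
    ...   | x₀ , x₀∈ , _ =
      ‖ m ‖ , ((m , Lm , refl) , L-bound) ,
      ((x , x∈ , trans x-norm (sym formula)) , λ y y∈ → subst (‖ y ‖ ℕ.≤_) (sym formula) (tL-bound y y∈))
      where
      m = argmax ‖_‖ x₀ ls
      formula = [1+t′][d+n]∸n≡[1+t′]d+nt′ t′ ‖ m ‖ n
      Lm : L m
      Lm = argmax-all ‖_‖ (from (L⇔ x₀) x₀∈) (ListAll.tabulate (λ {a} a∈ → from (L⇔ a) a∈))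
      L-bound : ∀ a → L a → ‖ a ‖ ℕ.≤ ‖ m ‖
      L-bound a La = ListAll.lookup (f[xs]≤f[argmax] x₀ ls) (to (L⇔ a) La)
      x = (T ·ᵥ m) +ᵥ corner n
      x∈ : scale t L x
      x∈ = m , Lm , corner n , corner-box n , refl
      x-norm : ‖ x ‖ ≡ t ℕ.* ‖ m ‖ ℕ.+ n ℕ.* t′
      x-norm = trans (norm-affine m (corner n) (orthant m Lm) (box-nonneg (corner-box n)))
                     (cong (t ℕ.* ‖ m ‖ ℕ.+_) (corner-norm n))
      tL-bound : ∀ y → scale t L y → ‖ y ‖ ℕ.≤ t ℕ.* ‖ m ‖ ℕ.+ n ℕ.* t′
      tL-bound y y∈ = subst (ℕ._≤ _) (sym (norm-divMod y (to (inOrthant-scale⇔ L) orthant y y∈)))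
        (ℕP.+-mono-≤ (ℕP.*-monoʳ-≤ t (L-bound (quot y) (to (scale⇔ L y) y∈))) (box-norm (rem-box y)))

    Minimal : Mat n → CubeSet n → Set
    Minimal K H = ∀ a → H a → ∀ x → Nonneg x → x ≡ a [mod K ] → ‖ a ‖ ℕ.≤ ‖ x ‖

    minimal-scale : ∀ (H : CubeSet n) → InOrthant H → Minimal M H → Minimal tM (scale t H)
    minimal-scale H orthant minimal x x∈ y y≥0 y≡x = begin
      ‖ x ‖                                  ≡⟨ norm-divMod x (to (inOrthant-scale⇔ H) orthant x x∈) ⟩
      t ℕ.* ‖ quot x ‖ ℕ.+ ‖ rem x ‖         ≤⟨ ℕP.+-monoˡ-≤ ‖ rem x ‖ (ℕP.*-monoʳ-≤ t quot-minimal) ⟩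
      t ℕ.* ‖ quot y ‖ ℕ.+ ‖ rem x ‖         ≡⟨ cong (λ r → t ℕ.* ‖ quot y ‖ ℕ.+ ‖ r ‖) (proj₁ digits) ⟨
      t ℕ.* ‖ quot y ‖ ℕ.+ ‖ rem y ‖         ≡⟨ norm-divMod y y≥0 ⟨
      ‖ y ‖                                  ∎
      where
      open ℕP.≤-Reasoning
      digits = to (≡mod-scaled⇔ M y x) y≡x
      quot-minimal = minimal (quot x) (to (scale⇔ H x) x∈) (quot y) (quot-nonneg y y≥0) (proj₂ digits)

    minimal-unscale : ∀ (H : CubeSet n) → InOrthant H → Minimal tM (scale t H) → Minimal M H
    minimal-unscale H orthant minimal a Ha x x≥0 x≡a = ℕP.*-cancelˡ-≤ t (subst₂ ℕ._≤_
      (norm-multiple (orthant a Ha)) (norm-multiple x≥0)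
      (minimal (T ·ᵥ a) (from (scale-multiple⇔ H a) Ha) (T ·ᵥ x) (multiple-nonneg x≥0) (·ᵥ-≡mod x≡a)))

    mdd-scale⇔ : ∀ (H : CubeSet n) → MDD M H ⇔ MDD tM (scale t H)
    mdd-scale⇔ H = mk⇔
      (λ (hyperL , minimal) → to (hyperL-scale⇔ H) hyperL , minimal-scale H (orthant hyperL) minimal)
      (λ (hyperLᵗ , minimal) → let hyperL = from (hyperL-scale⇔ H) hyperLᵗ in
        hyperL , minimal-unscale H (orthant hyperL) minimal)
      where
      orthant : HyperL M H → InOrthant H
      orthant = proj₁

    covers-scale : ∀ {d} → Covers M d → Covers tM (t ℕ.* d ℕ.+ n ℕ.* t′)
    covers-scale {d} covers g with covers (quot g)
    ... | x , x≥0 , x≡quot-g , short = y , y≥0 , y≡g , y-short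
      where
      y = (T ·ᵥ x) +ᵥ rem g
      y-digits = quot-rem-unique y x (rem g) (rem-box g) refl
      y≥0 = affine-nonneg x (rem g) x≥0 (box-nonneg (rem-box g))
      y≡g : y ≡ g [mod tM ]
      y≡g = from (≡mod-scaled⇔ M y g) (proj₂ y-digits , subst (λ q → q ≡ quot g [mod M ]) (sym (proj₁ y-digits)) x≡quot-g)
      y-short : ‖ y ‖ ℕ.≤ t ℕ.* d ℕ.+ n ℕ.* t′
      y-short = subst (ℕ._≤ _) (sym (norm-affine x (rem g) x≥0 (box-nonneg (rem-box g))))
        (ℕP.+-mono-≤ (ℕP.*-monoʳ-≤ t short) (box-norm (rem-box g)))

    far-scale : ∀ {d} → Far M d → Far tM (t ℕ.* d ℕ.+ n ℕ.* t′)
    far-scale {d} (g , far) = G , λ x x≥0 x≡G → begin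
      t ℕ.* d ℕ.+ n ℕ.* t′                  ≤⟨ ℕP.+-monoˡ-≤ (n ℕ.* t′) (ℕP.*-monoʳ-≤ t (far (quot x) (quot-nonneg x x≥0) (quot≡ x x≡G))) ⟩
      t ℕ.* ‖ quot x ‖ ℕ.+ n ℕ.* t′         ≡⟨ cong (t ℕ.* ‖ quot x ‖ ℕ.+_) (trans (sym (corner-norm n)) (cong ‖_‖ (sym (rem≡ x x≡G)))) ⟩
      t ℕ.* ‖ quot x ‖ ℕ.+ ‖ rem x ‖        ≡⟨ norm-divMod x x≥0 ⟨
      ‖ x ‖                                 ∎
      where
      open ℕP.≤-Reasoning
      G = (T ·ᵥ g) +ᵥ corner n
      G-digits = quot-rem-unique G g (corner n) (corner-box n) refl
      rem≡ : ∀ x → x ≡ G [mod tM ] → rem x ≡ corner n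
      rem≡ x x≡G = trans (proj₁ (to (≡mod-scaled⇔ M x G) x≡G)) (proj₂ G-digits)
      quot≡ : ∀ x → x ≡ G [mod tM ] → quot x ≡ g [mod M ]
      quot≡ x x≡G = subst (λ q → quot x ≡ q [mod M ]) (proj₁ G-digits) (proj₂ (to (≡mod-scaled⇔ M x G) x≡G))

    digraphDiameter-scale : ∀ {d} → IsDigraphDiameter M d → IsDigraphDiameter tM (t ℕ.* (d ℕ.+ n) ℕ.∸ n)
    digraphDiameter-scale {d} diameter = from (digraphDiameter⇔ tM _)
      (subst (λ e → Covers tM e × Far tM e) (sym ([1+t′][d+n]∸n≡[1+t′]d+nt′ t′ d n))
        (covers-scale (proj₁ (to (digraphDiameter⇔ M d) diameter)) , far-scale (proj₂ (to (digraphDiameter⇔ M d) diameter))))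

  -- Existence of the diameter

  ∃-with-failing-predecessor : ∀ {P : ℕ → Set} → (∀ m → Dec (P m)) → ∀ N → P N →
    ∃ λ d → P d × (∀ d′ → d ≡ suc d′ → ¬ P d′)
  ∃-with-failing-predecessor P? zero    P0 = zero , P0 , λ _ ()
  ∃-with-failing-predecessor P? (suc N) PN₁ with P? N
  ... | yes PN  = ∃-with-failing-predecessor P? N PN
  ... | no  ¬PN = suc N , PN₁ , λ { _ refl → ¬PN }

  module DiameterExists {n} (M : Mat n) (B′ : ℕ) (B-multiples : ∀ y → ∃ λ x → M ⊛ x ≡ (+ suc B′) ·ᵥ y) where

    open Division B′
    open Equivalence using (to; from)

    ≡mod-rem : ∀ g → g ≡ rem g [mod M ]
    ≡mod-rem g = let x , Mx≡ = B-multiples (quot g) in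
      x , trans (+ᵥ-transpose g (rem g) (T ·ᵥ quot g) (trans (divMod g) (+ᵥ-comm (T ·ᵥ quot g) (rem g)))) (sym Mx≡)

    -- a − b ∈ M ℤⁿ iff a − b − M y ∈ B ℤⁿ for some y in the box
    ≡mod⇔ : ∀ a b → a ≡ b [mod M ] ⇔ ListAny.Any (λ y → rem ((a -ᵥ b) -ᵥ (M ⊛ y)) ≡ 0ᵥ n) (boxList n)
    ≡mod⇔ a b = mk⇔ via-remainder via-multiple
      where
      open ≡-Reasoning
      via-remainder : a ≡ b [mod M ] → ListAny.Any (λ y → rem ((a -ᵥ b) -ᵥ (M ⊛ y)) ≡ 0ᵥ n) (boxList n)
      via-remainder (x , a-b≡Mx) = lose (∈-boxList⁺ (rem-box x)) (begin
        rem ((a -ᵥ b) -ᵥ (M ⊛ rem x))     ≡⟨ cong rem (+ᵥ-transpose (a -ᵥ b) (M ⊛ rem x) (M ⊛ (T ·ᵥ quot x)) split) ⟩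
        rem (M ⊛ (T ·ᵥ quot x))           ≡⟨ cong rem (⊛-·ᵥ M T (quot x)) ⟩
        rem (T ·ᵥ (M ⊛ quot x))           ≡⟨ proj₂ (quot-rem-multiple (M ⊛ quot x)) ⟩
        0ᵥ n                              ∎)
        where
        split : a -ᵥ b ≡ (M ⊛ rem x) +ᵥ (M ⊛ (T ·ᵥ quot x))
        split = begin
          a -ᵥ b                                   ≡⟨ a-b≡Mx ⟩
          M ⊛ x                                    ≡⟨ cong (M ⊛_) (divMod x) ⟩
          M ⊛ ((T ·ᵥ quot x) +ᵥ rem x)             ≡⟨ ⊛-+ᵥ M (T ·ᵥ quot x) (rem x) ⟩
          (M ⊛ (T ·ᵥ quot x)) +ᵥ (M ⊛ rem x)       ≡⟨ +ᵥ-comm (M ⊛ (T ·ᵥ quot x)) (M ⊛ rem x) ⟩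
          (M ⊛ rem x) +ᵥ (M ⊛ (T ·ᵥ quot x))       ∎
      via-multiple : ListAny.Any (λ y → rem ((a -ᵥ b) -ᵥ (M ⊛ y)) ≡ 0ᵥ n) (boxList n) → a ≡ b [mod M ]
      via-multiple found with find found
      ... | y , _ , rem≡0 with B-multiples (quot ((a -ᵥ b) -ᵥ (M ⊛ y)))
      ...   | z , Mz≡ = y +ᵥ z , (begin
        a -ᵥ b                         ≡⟨ -ᵥ-transpose (a -ᵥ b) (M ⊛ y) v refl ⟩
        (M ⊛ y) +ᵥ v                   ≡⟨ cong ((M ⊛ y) +ᵥ_) v≡ ⟩
        (M ⊛ y) +ᵥ (T ·ᵥ quot v)       ≡⟨ cong ((M ⊛ y) +ᵥ_) Mz≡ ⟨
        (M ⊛ y) +ᵥ (M ⊛ z)             ≡⟨ ⊛-+ᵥ M y z ⟨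
        M ⊛ (y +ᵥ z)                   ∎)
        where
        v = (a -ᵥ b) -ᵥ (M ⊛ y)
        v≡ : v ≡ T ·ᵥ quot v
        v≡ = trans (divMod v) (trans (cong ((T ·ᵥ quot v) +ᵥ_) rem≡0) (+ᵥ-identityʳ (T ·ᵥ quot v)))

    ≡mod? : ∀ a b → Dec (a ≡ b [mod M ])
    ≡mod? a b = map′ (from (≡mod⇔ a b)) (to (≡mod⇔ a b))
      (ListAny.any? (λ y → rem ((a -ᵥ b) -ᵥ (M ⊛ y)) ≟ᵥ 0ᵥ n) (boxList n))

    ReachedWithin : ℕ → Vecℤ n → Set
    ReachedWithin m b = ListAny.Any (λ x → x ≡ b [mod M ] × ‖ x ‖ ℕ.≤ m) (boxList n)

    reachedWithin? : ∀ m b → Dec (ReachedWithin m b)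
    reachedWithin? m b = ListAny.any? (λ x → ≡mod? x b ×-dec (‖ x ‖ ℕ.≤? m)) (boxList n)

    CoveredWithin : ℕ → Set
    CoveredWithin m = ListAll.All (ReachedWithin m) (boxList n)

    coveredWithin-box : CoveredWithin (n ℕ.* B′)
    coveredWithin-box = ListAll.tabulate λ {b} b∈ → lose b∈ (≡mod-refl M b , box-norm (∈-boxList⁻ n b∈))

    coveredWithin⇒covers : ∀ {m} → CoveredWithin m → Covers M m
    coveredWithin⇒covers covered g with find (ListAll.lookup covered (∈-boxList⁺ (rem-box g)))
    ... | x , x∈ , x≡rem , short = x , box-nonneg (∈-boxList⁻ n x∈) , ≡mod-trans M x≡rem (≡mod-sym M (≡mod-rem g)) , short

    -- an unreached b ∈ [0, B)ⁿ is far: any x ≥ 0 in its class has remainder rem x ≡ b with ‖rem x‖ ≤ ‖x‖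
    ¬coveredWithin⇒far : ∀ {m} → ¬ CoveredWithin m → Far M (suc m)
    ¬coveredWithin⇒far {m} uncovered with find (¬All⇒Any¬ (reachedWithin? m) (boxList n) uncovered)
    ... | b , _ , unreached = b , λ x x≥0 x≡b → ℕP.≤-trans
      (ℕP.≰⇒> λ short → unreached (lose (∈-boxList⁺ (rem-box x)) (≡mod-trans M (≡mod-sym M (≡mod-rem x)) x≡b , short)))
      (subst (‖ rem x ‖ ℕ.≤_) (sym (norm-divMod x x≥0)) (ℕP.m≤n+m _ _))

    digraphDiameter-exists : ∃ λ d → IsDigraphDiameter M d
    digraphDiameter-exists
      with ∃-with-failing-predecessor (λ m → ListAll.all? (reachedWithin? m) (boxList n)) (n ℕ.* B′) coveredWithin-box
    ... | zero  , covered , _ =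
      zero , from (digraphDiameter⇔ M zero) (coveredWithin⇒covers covered , 0ᵥ n , λ _ _ _ → z≤n)
    ... | suc d , covered , predecessor-fails = suc d , from (digraphDiameter⇔ M (suc d))
      (coveredWithin⇒covers covered , ¬coveredWithin⇒far (predecessor-fails d refl))

open import Data.Nat using (ℕ; suc; _≤_; _+_; _*_; _∸_)
open import Data.Integer using (+_)
open import Data.Product using (∃; _×_; _,_)
open import Relation.Binary.PropositionalEquality using (_≢_)
open import Function.Bundles using (_⇔_)
open Lattices using (det≢0⇒multiples-in-image; module Scaling; module DiameterExists)

theorem1 : (n : ℕ) → 1 ≤ n → (M : Mat n) → det n M ≢ + 0 → (t : ℕ) → 1 ≤ t →
      ((L : CubeSet n) → HyperL M L ⇔ HyperL ((+ t) ·ₘ M) (scale t L))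
    × ((L : CubeSet n) → HyperL M L →
         ∃ λ d → IsDiameter L d × IsDiameter (scale t L) (t * (d + n) ∸ n))
    × ((H : CubeSet n) → MDD M H ⇔ MDD ((+ t) ·ₘ M) (scale t H))
    × (∃ λ d → IsDigraphDiameter M d × IsDigraphDiameter ((+ t) ·ₘ M) (t * (d + n) ∸ n))
theorem1 n _ M det≢0 (suc t′) _ with det≢0⇒multiples-in-image n M det≢0
... | B′ , B-multiples with DiameterExists.digraphDiameter-exists M B′ B-multiples
...   | d , diameter =
  hyperL-scale⇔ , diameter-scale , mdd-scale⇔ , d , diameter , digraphDiameter-scale diameter
  where open Scaling t′ M
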